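{- There exists $t_0$ such that for every integer $t\geq t_0$, with $d=4t\ln t$, every $d$-regular (finite, simple) graph $G$ contains a dominating pseudo-$K_t$-model.
   Context: A dominating pseudo-$K_t$-model in a graph $G$ is a sequence $(V_1,\dots,V_t)$ of pairwise disjoint non-empty subsets of $V(G)$ such that for all $1\le i<j\le t$, every vertex of $V_j$ has a neighbour in $V_i$ (no connectivity is required). -}

module Defs where

open import Data.Nat using (ℕ; zero; suc; _+_; _*_; _^_; _≤_; _<_; _!)
open import Data.Fin using (Fin) renaming (_<_ to _<ᶠ_)
open import Data.Fin.Subset using (Subset; _∈_; _∉_; ∣_∣; Nonempty)
open import Data.Product using (Σ; ∃; _×_)
open import Relation.Nullary using (¬_)
open import Relation.Binary.PropositionalEquality using (_≡_)

record Graph (n : ℕ) : Set where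
  field
    nbr       : Fin n → Subset n
    symmetric : ∀ u v → v ∈ nbr u → u ∈ nbr v
    loopless  : ∀ v → v ∉ nbr v
open Graph public

Adj : ∀ {n} → Graph n → Fin n → Fin n → Set
Adj G u v = v ∈ nbr G u

Regular : ∀ {n} → ℕ → Graph n → Set
Regular d G = ∀ v → ∣ nbr G v ∣ ≡ d

DomPseudoModel : ∀ {n} → Graph n → (t : ℕ) → (Fin t → Subset n) → Set
DomPseudoModel G t V =
  (∀ i → Nonempty (V i)) ×
  (∀ i j → ¬ (i ≡ j) → ∀ x → x ∈ V i → x ∉ V j) ×
  (∀ i j → i <ᶠ j → ∀ v → v ∈ V j → ∃ λ u → u ∈ V i × Adj G v u)

HasDomPseudoModel : ∀ {n} → Graph n → ℕ → Set
HasDomPseudoModel {n} G t = ∃ λ (V : Fin t → Subset n) → DomPseudoModel G t V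

-- expSum d m = m! * Σ_{k=0}^{m} d^k / k!   (an exact natural number)
expSum : ℕ → ℕ → ℕ
expSum d zero    = 1
expSum d (suc m) = suc m * expSum d m + d ^ suc m

-- "e^d ≥ N": some partial sum of the exponential series reaches N
-- (equivalent since the partial sums increase to e^d and e^d is irrational for d ≥ 1).
ExpAtLeast : ℕ → ℕ → Set
ExpAtLeast d N = ∃ λ m → N * (m !) ≤ expSum d m

-- "4 t ln t ≤ d"  ⇔  t^(4t) ≤ e^d
FourTLnTLe : ℕ → ℕ → Set
FourTLnTLe t d = ExpAtLeast d (t ^ (4 * t))

IsCeil4TLnT : ℕ → ℕ → Set
IsCeil4TLnT t d = FourTLnTLe t d × (∀ d′ → d′ < d → ¬ FourTLnTLe t d′)

{-# OPTIONS --safe #-}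
module Submission where

-- Colour the vertices uniformly at random with t colours and let V_i be the i-th colour
-- class; this is a dominating pseudo-K_t-model as soon as every vertex sees all t colours
-- in its neighbourhood.  A vertex misses some colour with probability at most
-- t (1 - 1/t)^d, and this event depends only on the colours of its neighbours, so it is
-- mutually independent of the events of all vertices sharing no neighbour with it, i.e.
-- of all but d² of them.  The symmetric local lemma (proved here by counting colourings)
-- therefore applies once 4 d² t (1 - 1/t)^d ≤ 1.  For d ≥ 4 t ln t this follows from
-- (1 - 1/t)^d ≈ e^(-d/t) ≤ t^(-4) when t is large; the estimate is made effective with
-- partial sums of e^d, a crude Stirling bound and Bernoulli-type inequalities.

open import Data.Bool using (Bool; true; false; not; _∧_; _∨_)
open import Data.Bool.Properties
  using (∧-conicalˡ; ∧-conicalʳ; ∨-conicalˡ; ∨-conicalʳ; ∨-identityʳ; ∧-zeroʳ; not-injective)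
open import Data.Empty using (⊥-elim)
open import Data.Fin using (Fin; zero; suc; fromℕ<) renaming (_<_ to _<ᶠ_)
open import Data.Fin.Properties using () renaming (_≟_ to _≟ᶠ_)
open import Data.Fin.Subset using (Subset; _∈_; _∉_; ∣_∣; Nonempty)
open import Data.Nat
open import Data.Nat.DivMod using (_/_; _%_; m≡m%n+[m/n]*n; m%n<n)
open import Data.Nat.Properties
open import Data.Nat.Tactic.RingSolver using (solve-∀)
open import Data.Product using (∃; _×_; _,_; proj₁; proj₂)
open import Data.Sum using (inj₁; inj₂)
open import Data.Vec using (_∷_; []; lookup; tabulate)
open import Data.Vec.Properties using ([]=⇒lookup; lookup⇒[]=; lookup∘tabulate)
open import Function using (_∘_)
open import Relation.Binary.PropositionalEquality
  using (_≡_; refl; sym; trans; cong; cong₂; subst; subst₂)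
open import Relation.Nullary using (¬_; does; yes; no)
open import Relation.Nullary.Decidable using (dec-true)
open import Algebra.Properties.CommutativeSemigroup *-commutativeSemigroup
  using (x∙yz≈y∙xz; xy∙z≈xz∙y; xy∙z≈y∙xz; xy∙z≈x∙zy; x∙yz≈xy∙z)
open import Algebra.Properties.Semiring.Sum +-*-semiring
  using (sum; sum-syntax; sum-cong-≗; sum-replicate-zero; ∑-distrib-+; ∑-comm; *-distribˡ-sum; *-distribʳ-sum)

open import Defs

open ≤-Reasoning

^-distribʳ-* : ∀ a b n → (a * b) ^ n ≡ a ^ n * b ^ n
^-distribʳ-* a b zero    = refl
^-distribʳ-* a b (suc n) = begin-equality
  a * b * (a * b) ^ n      ≡⟨ cong (a * b *_) (^-distribʳ-* a b n) ⟩
  a * b * (a ^ n * b ^ n)  ≡⟨ interchange a b (a ^ n) (b ^ n) ⟩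
  a * a ^ n * (b * b ^ n)  ∎
  where
  interchange : ∀ a b x y → a * b * (x * y) ≡ a * x * (b * y)
  interchange = solve-∀

^-cancelʳ-≤ : ∀ k {a b} → a ^ suc k ≤ b ^ suc k → a ≤ b
^-cancelʳ-≤ k {a} {b} h with a ≤? b
... | yes a≤b = a≤b
... | no  a≰b = ⊥-elim (<⇒≱ (^-monoˡ-< (suc k) (≰⇒> a≰b)) h)

m≤m^n : ∀ m n → 1 ≤ m → 1 ≤ n → m ≤ m ^ n
m≤m^n m n 1≤m 1≤n = begin
  m      ≡⟨ *-identityʳ m ⟨
  m ^ 1  ≤⟨ ^-monoʳ-≤ m {{>-nonZero 1≤m}} 1≤n ⟩
  m ^ n  ∎

suc[k+m]^k*m≤[k+m]^suc[k] : ∀ k m → suc (k + m) ^ k * m ≤ (k + m) ^ suc k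
suc[k+m]^k*m≤[k+m]^suc[k] zero m = ≤-reflexive (trans (+-identityʳ m) (sym (*-identityʳ m)))
suc[k+m]^k*m≤[k+m]^suc[k] (suc k) m = *-cancelʳ-≤ _ _ (suc m) (begin
  suc n * A * m * suc m    ≡⟨ shuffle₁ A m n ⟩
  A * suc m * (suc n * m)  ≤⟨ *-monoˡ-≤ (suc n * m) IH ⟩
  B * (suc n * m)          ≤⟨ *-monoʳ-≤ B [1+n]m≤n[1+m] ⟩
  B * (n * suc m)          ≡⟨ shuffle₂ B n m ⟩
  n * B * suc m            ∎)
  where
  n = suc k + m
  A = suc n ^ k
  B = n ^ suc k
  IH : A * suc m ≤ B
  IH = subst (λ x → suc x ^ k * suc m ≤ x ^ suc k) (+-suc k m) (suc[k+m]^k*m≤[k+m]^suc[k] k (suc m))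
  [1+n]m≤n[1+m] : suc n * m ≤ n * suc m
  [1+n]m≤n[1+m] = subst (suc n * m ≤_) (sym (*-suc n m)) (+-monoˡ-≤ (n * m) (m≤n+m m (suc k)))
  shuffle₁ : ∀ A m n → suc n * A * m * suc m ≡ A * suc m * (suc n * m)
  shuffle₁ = solve-∀
  shuffle₂ : ∀ B n m → B * (n * suc m) ≡ n * B * suc m
  shuffle₂ = solve-∀

m!*m^n≤[m+n]! : ∀ m n → m ! * m ^ n ≤ (m + n) !
m!*m^n≤[m+n]! m zero = ≤-reflexive (trans (*-identityʳ (m !)) (cong _! (sym (+-identityʳ m))))
m!*m^n≤[m+n]! m (suc n) = begin
  m ! * (m * m ^ n)        ≡⟨ x∙yz≈y∙xz (m !) m (m ^ n) ⟩
  m * (m ! * m ^ n)        ≤⟨ *-mono-≤ (m≤m+n m n) (m!*m^n≤[m+n]! m n) ⟩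
  (m + n) * (m + n) !      ≤⟨ *-monoˡ-≤ ((m + n) !) (n≤1+n (m + n)) ⟩
  suc (m + n) * (m + n) !  ≡⟨ cong _! (+-suc m n) ⟨
  (m + suc n) !            ∎

[m+n]!≤m!*[m+n]^n : ∀ m n → (m + n) ! ≤ m ! * (m + n) ^ n
[m+n]!≤m!*[m+n]^n m zero = ≤-reflexive (trans (cong _! (+-identityʳ m)) (sym (*-identityʳ (m !))))
[m+n]!≤m!*[m+n]^n m (suc n) = begin
  (m + suc n) !                          ≡⟨ cong _! (+-suc m n) ⟩
  suc (m + n) * (m + n) !                ≤⟨ *-monoʳ-≤ (suc (m + n)) ([m+n]!≤m!*[m+n]^n m n) ⟩
  suc (m + n) * (m ! * (m + n) ^ n)      ≤⟨ *-monoʳ-≤ (suc (m + n)) (*-monoʳ-≤ (m !) (^-monoˡ-≤ n (n≤1+n (m + n)))) ⟩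
  suc (m + n) * (m ! * suc (m + n) ^ n)  ≡⟨ x∙yz≈y∙xz (suc (m + n)) (m !) (suc (m + n) ^ n) ⟩
  m ! * suc (m + n) ^ suc n              ≡⟨ cong (λ x → m ! * x ^ suc n) (+-suc m n) ⟨
  m ! * (m + suc n) ^ suc n              ∎

d^k*d!≤k!*d^d : ∀ d k → d ^ k * d ! ≤ k ! * d ^ d
d^k*d!≤k!*d^d d k with ≤-total k d
... | inj₁ k≤d with m≤n⇒∃[o]m+o≡n k≤d
...   | j , refl = begin
  d ^ k * (k + j) !      ≤⟨ *-monoʳ-≤ (d ^ k) ([m+n]!≤m!*[m+n]^n k j) ⟩
  d ^ k * (k ! * d ^ j)  ≡⟨ x∙yz≈y∙xz (d ^ k) (k !) (d ^ j) ⟩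
  k ! * (d ^ k * d ^ j)  ≡⟨ cong (k ! *_) (^-distribˡ-+-* d k j) ⟨
  k ! * d ^ (k + j)      ∎
d^k*d!≤k!*d^d d k | inj₂ d≤k with m≤n⇒∃[o]m+o≡n d≤k
...   | j , refl = begin
  d ^ (d + j) * d !      ≡⟨ cong (_* d !) (^-distribˡ-+-* d d j) ⟩
  d ^ d * d ^ j * d !    ≡⟨ shuffle (d ^ d) (d ^ j) (d !) ⟩
  d ! * d ^ j * d ^ d    ≤⟨ *-monoˡ-≤ (d ^ d) (m!*m^n≤[m+n]! d j) ⟩
  (d + j) ! * d ^ d      ∎
  where
  shuffle : ∀ a b c → a * b * c ≡ c * b * a
  shuffle = solve-∀

expSum*d!≤m!*[1+m]*d^d : ∀ d m → expSum d m * d ! ≤ m ! * suc m * d ^ d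
expSum*d!≤m!*[1+m]*d^d d zero = begin
  1 * d !        ≡⟨ *-identityˡ (d !) ⟩
  d !            ≤⟨ [m+n]!≤m!*[m+n]^n 0 d ⟩
  1 * d ^ d      ≡⟨ cong (_* d ^ d) (*-identityˡ 1) ⟨
  1 * 1 * d ^ d  ∎
expSum*d!≤m!*[1+m]*d^d d (suc m) = begin
  (suc m * E + d ^ suc m) * d !                       ≡⟨ shuffle₁ (suc m) E (d ^ suc m) (d !) ⟩
  suc m * (E * d !) + d ^ suc m * d !                 ≤⟨ +-mono-≤ (*-monoʳ-≤ (suc m) (expSum*d!≤m!*[1+m]*d^d d m))
                                                                   (d^k*d!≤k!*d^d d (suc m)) ⟩
  suc m * (m ! * suc m * d ^ d) + suc m * m ! * d ^ d ≡⟨ shuffle₂ (suc m) (m !) (d ^ d) ⟩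
  suc m * m ! * suc (suc m) * d ^ d                   ∎
  where
  E = expSum d m
  shuffle₁ : ∀ s E X F → (s * E + X) * F ≡ s * (E * F) + X * F
  shuffle₁ = solve-∀
  shuffle₂ : ∀ s p D → s * (p * s * D) + s * p * D ≡ s * p * suc s * D
  shuffle₂ = solve-∀

-- Up to m = 2d every term d^k/k! is bounded by d^d/d!; beyond, consecutive terms
-- at least halve, and the summand 2 d^(m+1) carries the geometric tail.
expSum-tail : ∀ d m → (expSum d m * suc m + 2 * d ^ suc m) * d ! ≤ suc m ! * (2 * d + 3) * d ^ d
expSum-tail d m with m ≤? 2 * d
... | yes m≤2d = begin
  (E * s + 2 * X) * d !                     ≡⟨ shuffle₁ E s X (d !) ⟩
  E * d ! * s + 2 * (X * d !)               ≤⟨ +-mono-≤ (*-monoˡ-≤ s (expSum*d!≤m!*[1+m]*d^d d m))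
                                                        (*-monoʳ-≤ 2 (d^k*d!≤k!*d^d d s)) ⟩
  m ! * s * D * s + 2 * (s * m ! * D)       ≡⟨ shuffle₂ (m !) s D ⟩
  s * m ! * (s + 2) * D                     ≤⟨ *-monoˡ-≤ D (*-monoʳ-≤ (s * m !) s+2≤2d+3) ⟩
  s * m ! * (2 * d + 3) * D                 ∎
  where
  s = suc m
  E = expSum d m
  X = d ^ s
  D = d ^ d
  s+2≤2d+3 : s + 2 ≤ 2 * d + 3
  s+2≤2d+3 = subst (_≤ 2 * d + 3) (+-suc m 2) (+-monoˡ-≤ 3 m≤2d)
  shuffle₁ : ∀ E s X F → (E * s + 2 * X) * F ≡ E * F * s + 2 * (X * F)
  shuffle₁ = solve-∀
  shuffle₂ : ∀ p s D → p * s * D * s + 2 * (s * p * D) ≡ s * p * (s + 2) * D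
  shuffle₂ = solve-∀
expSum-tail d zero | no 0≰2d = ⊥-elim (0≰2d z≤n)
expSum-tail d (suc m) | no m≰2d = begin
  ((s * E + X) * suc s + 2 * (d * X)) * d !  ≤⟨ *-monoˡ-≤ (d !) next-term-halves ⟩
  suc s * (E * s + 2 * X) * d !              ≡⟨ *-assoc (suc s) (E * s + 2 * X) (d !) ⟩
  suc s * ((E * s + 2 * X) * d !)            ≤⟨ *-monoʳ-≤ (suc s) (expSum-tail d m) ⟩
  suc s * (s ! * C * D)                      ≡⟨ shuffle (suc s) (s !) C D ⟩
  suc s * s ! * C * D                        ∎
  where
  s = suc m
  E = expSum d m
  X = d ^ s
  C = 2 * d + 3
  D = d ^ d
  2d≤s+1 : 2 * d ≤ suc s
  2d≤s+1 = ≤-trans (≤-pred (≰⇒> m≰2d)) (≤-trans (n≤1+n m) (n≤1+n s))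
  next-term-halves : (s * E + X) * suc s + 2 * (d * X) ≤ suc s * (E * s + 2 * X)
  next-term-halves = begin
    (s * E + X) * suc s + 2 * (d * X)              ≡⟨ expand s E X d ⟩
    suc s * (E * s) + (X * suc s + X * (2 * d))    ≤⟨ +-monoʳ-≤ (suc s * (E * s)) (+-monoʳ-≤ (X * suc s) (*-monoʳ-≤ X 2d≤s+1)) ⟩
    suc s * (E * s) + (X * suc s + X * suc s)      ≡⟨ collect s E X ⟩
    suc s * (E * s + 2 * X)                        ∎
    where
    expand : ∀ s E X d → (s * E + X) * suc s + 2 * (d * X) ≡ suc s * (E * s) + (X * suc s + X * (2 * d))
    expand = solve-∀
    collect : ∀ s E X → suc s * (E * s) + (X * suc s + X * suc s) ≡ suc s * (E * s + 2 * X)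
    collect = solve-∀
  shuffle : ∀ s p C D → s * (p * C * D) ≡ s * p * C * D
  shuffle = solve-∀

expSum*d!≤m!*[2d+3]*d^d : ∀ d m → expSum d m * d ! ≤ m ! * (2 * d + 3) * d ^ d
expSum*d!≤m!*[2d+3]*d^d d m = *-cancelʳ-≤ _ _ (suc m) (begin
  expSum d m * d ! * suc m                          ≡⟨ xy∙z≈xz∙y (expSum d m) (d !) (suc m) ⟩
  expSum d m * suc m * d !                          ≤⟨ *-monoˡ-≤ (d !) (m≤m+n (expSum d m * suc m) (2 * d ^ suc m)) ⟩
  (expSum d m * suc m + 2 * d ^ suc m) * d !        ≤⟨ expSum-tail d m ⟩
  suc m * m ! * (2 * d + 3) * d ^ d                 ≡⟨ shuffle (suc m) (m !) (2 * d + 3) (d ^ d) ⟩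
  m ! * (2 * d + 3) * d ^ d * suc m                 ∎)
  where
  shuffle : ∀ s p C D → s * p * C * D ≡ p * C * D * s
  shuffle = solve-∀

⌈n/4⌉-split : ∀ n → ∃ λ k → ∃ λ m → ∃ λ e → k + m ≡ n × 4 * k ≡ n + e × e ≤ 3
⌈n/4⌉-split zero = 0 , 0 , 0 , refl , refl , z≤n
⌈n/4⌉-split (suc n) with ⌈n/4⌉-split n
... | k , m , zero , k+m≡n , 4k≡n+0 , _ = suc k , m , 3 , cong suc k+m≡n , 4[1+k]≡1+n+3 , ≤-refl
  where
  4[1+k]≡1+n+3 : 4 * suc k ≡ suc n + 3
  4[1+k]≡1+n+3 = trans (*-suc 4 k) (trans (cong (4 +_) 4k≡n+0) (shuffle n))
    where
    shuffle : ∀ n → 4 + (n + 0) ≡ suc n + 3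
    shuffle = solve-∀
... | k , m , suc e , k+m≡n , 4k≡n+1+e , s≤s e≤2 =
  k , suc m , e , trans (+-suc k m) (cong suc k+m≡n) , trans 4k≡n+1+e (+-suc n e) , m≤n⇒m≤1+n e≤2

suc[n]^n*m^4≤n^[n+4] : ∀ n k m e → k + m ≡ n → 4 * k ≡ n + e → suc n ^ n * m ^ 4 ≤ n ^ (n + 4)
suc[n]^n*m^4≤n^[n+4] n k m e refl 4k≡n+e = *-cancelʳ-≤ _ _ (suc n ^ e) {{m^n≢0 (suc n) e}} (begin
  suc n ^ n * m ^ 4 * suc n ^ e    ≡⟨ xy∙z≈xz∙y (suc n ^ n) (m ^ 4) (suc n ^ e) ⟩
  suc n ^ n * suc n ^ e * m ^ 4    ≡⟨ cong (_* m ^ 4) (^-distribˡ-+-* (suc n) n e) ⟨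
  suc n ^ (n + e) * m ^ 4          ≡⟨ cong (λ x → suc n ^ x * m ^ 4) (trans (sym 4k≡n+e) (*-comm 4 k)) ⟩
  suc n ^ (k * 4) * m ^ 4          ≡⟨ cong (_* m ^ 4) (^-*-assoc (suc n) k 4) ⟨
  (suc n ^ k) ^ 4 * m ^ 4          ≡⟨ ^-distribʳ-* (suc n ^ k) m 4 ⟨
  (suc n ^ k * m) ^ 4              ≤⟨ ^-monoˡ-≤ 4 (suc[k+m]^k*m≤[k+m]^suc[k] k m) ⟩
  (n ^ suc k) ^ 4                  ≡⟨ ^-*-assoc n (suc k) 4 ⟩
  n ^ (suc k * 4)                  ≡⟨ cong (n ^_) (trans (*-comm (suc k) 4) (trans (*-suc 4 k) (cong (4 +_) 4k≡n+e))) ⟩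
  n ^ (4 + (n + e))                ≡⟨ cong (n ^_) (shuffle n e) ⟩
  n ^ ((n + 4) + e)                ≡⟨ ^-distribˡ-+-* n (n + 4) e ⟩
  n ^ (n + 4) * n ^ e              ≤⟨ *-monoʳ-≤ (n ^ (n + 4)) (^-monoˡ-≤ e (n≤1+n n)) ⟩
  n ^ (n + 4) * suc n ^ e          ∎)
  where
  shuffle : ∀ n e → 4 + (n + e) ≡ n + 4 + e
  shuffle = solve-∀

[2+p]^[1+p]*81*p^4≤256*[1+p]^[1+p+4] : ∀ p → suc (suc p) ^ suc p * 81 * p ^ 4 ≤ 256 * suc p ^ (suc p + 4)
[2+p]^[1+p]*81*p^4≤256*[1+p]^[1+p+4] p with ⌈n/4⌉-split (suc p)
... | k , m , e , k+m≡1+p , 4k≡1+p+e , e≤3 = begin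
  X * 81 * p ^ 4            ≡⟨ pull-81 X p ⟩
  X * (3 * p) ^ 4           ≤⟨ *-monoʳ-≤ X (^-monoˡ-≤ 4 3p≤4m) ⟩
  X * (4 * m) ^ 4           ≡⟨ pull-256 X m ⟩
  256 * (X * m ^ 4)         ≤⟨ *-monoʳ-≤ 256 (suc[n]^n*m^4≤n^[n+4] (suc p) k m e k+m≡1+p 4k≡1+p+e) ⟩
  256 * suc p ^ (suc p + 4) ∎
  where
  X = suc (suc p) ^ suc p
  4m+e≡3[1+p] : 4 * m + e ≡ 3 * suc p
  4m+e≡3[1+p] = +-cancelˡ-≡ (suc p) _ _ (begin-equality
    suc p + (4 * m + e)   ≡⟨ shuffle₁ (suc p) m e ⟩
    suc p + e + 4 * m     ≡⟨ cong (_+ 4 * m) 4k≡1+p+e ⟨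
    4 * k + 4 * m         ≡⟨ *-distribˡ-+ 4 k m ⟨
    4 * (k + m)           ≡⟨ cong (4 *_) k+m≡1+p ⟩
    4 * suc p             ≡⟨ shuffle₂ (suc p) ⟩
    suc p + 3 * suc p     ∎)
    where
    shuffle₁ : ∀ q m e → q + (4 * m + e) ≡ q + e + 4 * m
    shuffle₁ = solve-∀
    shuffle₂ : ∀ q → 4 * q ≡ q + 3 * q
    shuffle₂ = solve-∀
  3p≤4m : 3 * p ≤ 4 * m
  3p≤4m = +-cancelʳ-≤ 3 (3 * p) (4 * m) (begin
    3 * p + 3     ≡⟨ +-comm (3 * p) 3 ⟩
    3 + 3 * p     ≡⟨ *-suc 3 p ⟨
    3 * suc p     ≡⟨ 4m+e≡3[1+p] ⟨
    4 * m + e     ≤⟨ +-monoʳ-≤ (4 * m) e≤3 ⟩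
    4 * m + 3     ∎)
  pull-81 : ∀ x p → x * 81 * (p * (p * (p * (p * 1)))) ≡ x * ((3 * p) * ((3 * p) * ((3 * p) * ((3 * p) * 1))))
  pull-81 = solve-∀
  pull-256 : ∀ x m → x * ((4 * m) * ((4 * m) * ((4 * m) * ((4 * m) * 1)))) ≡ 256 * (x * (m * (m * (m * (m * 1)))))
  pull-256 = solve-∀

n^n*81^n≤256^n*[1+n]^4*n! : ∀ n → n ^ n * 81 ^ n ≤ 256 ^ n * suc n ^ 4 * n !
n^n*81^n≤256^n*[1+n]^4*n! 0 = ≤ᵇ⇒≤ _ _ _
n^n*81^n≤256^n*[1+n]^4*n! 1 = ≤ᵇ⇒≤ _ _ _
n^n*81^n≤256^n*[1+n]^4*n! (suc (suc q)) =
  ≤-trans (sharper q) (*-monoˡ-≤ (suc (suc q) !) (*-monoʳ-≤ (256 ^ suc (suc q)) (^-monoˡ-≤ 4 (m≤n+m (suc q) 2))))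
  where
  sharper : ∀ q → suc (suc q) ^ suc (suc q) * 81 ^ suc (suc q) ≤ 256 ^ suc (suc q) * suc q ^ 4 * suc (suc q) !
  sharper zero = ≤ᵇ⇒≤ _ _ _
  sharper (suc q) = *-cancelʳ-≤ _ _ (p ^ 4) {{m^n≢0 p 4}} (begin
    s * s ^ suc p * (81 * Y) * p ^ 4              ≡⟨ shuffle₁ s (s ^ suc p) Y (p ^ 4) ⟩
    s * Y * (s ^ suc p * 81 * p ^ 4)              ≤⟨ *-monoʳ-≤ (s * Y) ([2+p]^[1+p]*81*p^4≤256*[1+p]^[1+p+4] p) ⟩
    s * Y * (256 * suc p ^ (suc p + 4))           ≡⟨ cong (λ x → s * Y * (256 * x)) (^-distribˡ-+-* (suc p) (suc p) 4) ⟩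
    s * Y * (256 * (b * suc p ^ 4))               ≡⟨ shuffle₂ s Y b (suc p ^ 4) ⟩
    s * 256 * suc p ^ 4 * (b * Y)                 ≤⟨ *-monoʳ-≤ (s * 256 * suc p ^ 4) (sharper q) ⟩
    s * 256 * suc p ^ 4 * (Z * p ^ 4 * suc p !)   ≡⟨ shuffle₃ s (suc p ^ 4) Z (p ^ 4) (suc p !) ⟩
    256 * Z * suc p ^ 4 * (s * suc p !) * p ^ 4   ∎)
    where
    p = suc q
    s = suc (suc p)
    b = suc p ^ suc p
    Y = 81 ^ suc p
    Z = 256 ^ suc p
    shuffle₁ : ∀ s a y p4 → s * a * (81 * y) * p4 ≡ s * y * (a * 81 * p4)
    shuffle₁ = solve-∀
    shuffle₂ : ∀ s y b q4 → s * y * (256 * (b * q4)) ≡ s * 256 * q4 * (b * y)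
    shuffle₂ = solve-∀
    shuffle₃ : ∀ s q4 z p4 f → s * 256 * q4 * (z * p4 * f) ≡ 256 * z * q4 * (s * f) * p4
    shuffle₃ = solve-∀

-- e^d ≤ expBound d / 81^d
expBound : ℕ → ℕ
expBound d = (2 * d + 3) * suc d ^ 4 * 256 ^ d

expBound-mono : ∀ {d e} → d ≤ e → expBound d ≤ expBound e
expBound-mono d≤e =
  *-mono-≤ (*-mono-≤ (+-monoˡ-≤ 3 (*-monoʳ-≤ 2 d≤e)) (^-monoˡ-≤ 4 (s≤s d≤e))) (^-monoʳ-≤ 256 d≤e)

expSum*81^d≤m!*expBound : ∀ d m → expSum d m * 81 ^ d ≤ m ! * expBound d
expSum*81^d≤m!*expBound d m = *-cancelʳ-≤ _ _ (d !) {{d !≢0}} (begin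
  expSum d m * 81 ^ d * d !                         ≡⟨ xy∙z≈xz∙y (expSum d m) (81 ^ d) (d !) ⟩
  expSum d m * d ! * 81 ^ d                         ≤⟨ *-monoˡ-≤ (81 ^ d) (expSum*d!≤m!*[2d+3]*d^d d m) ⟩
  m ! * (2 * d + 3) * d ^ d * 81 ^ d                ≡⟨ *-assoc (m ! * (2 * d + 3)) (d ^ d) (81 ^ d) ⟩
  m ! * (2 * d + 3) * (d ^ d * 81 ^ d)              ≤⟨ *-monoʳ-≤ (m ! * (2 * d + 3)) (n^n*81^n≤256^n*[1+n]^4*n! d) ⟩
  m ! * (2 * d + 3) * (256 ^ d * suc d ^ 4 * d !)   ≡⟨ shuffle (m !) (2 * d + 3) (256 ^ d) (suc d ^ 4) (d !) ⟩
  m ! * expBound d * d !                            ∎)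
  where
  shuffle : ∀ p c z q4 f → p * c * (z * q4 * f) ≡ p * (c * q4 * z) * f
  shuffle = solve-∀

X*m!≤expSum⇒X*81^d≤expBound : ∀ X d m → X * m ! ≤ expSum d m → X * 81 ^ d ≤ expBound d
X*m!≤expSum⇒X*81^d≤expBound X d m h = *-cancelʳ-≤ _ _ (m !) {{m !≢0}} (begin
  X * 81 ^ d * m !      ≡⟨ xy∙z≈xz∙y X (81 ^ d) (m !) ⟩
  X * m ! * 81 ^ d      ≤⟨ *-monoˡ-≤ (81 ^ d) h ⟩
  expSum d m * 81 ^ d   ≤⟨ expSum*81^d≤m!*expBound d m ⟩
  m ! * expBound d      ≡⟨ *-comm (m !) (expBound d) ⟩
  expBound d * m !      ∎)

256*[6+m]^5≤260*[5+m]^5 : ∀ m → 320 ≤ m → 256 * suc (5 + m) ^ 5 ≤ 260 * (5 + m) ^ 5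
256*[6+m]^5≤260*[5+m]^5 m@(suc _) 320≤m = *-cancelʳ-≤ _ _ m (begin
  256 * X * m           ≡⟨ *-assoc 256 X m ⟩
  256 * (X * m)         ≤⟨ *-monoʳ-≤ 256 (suc[k+m]^k*m≤[k+m]^suc[k] 5 m) ⟩
  256 * ((5 + m) * Y)   ≡⟨ x∙yz≈xy∙z 256 (5 + m) Y ⟩
  256 * (5 + m) * Y     ≤⟨ *-monoˡ-≤ Y linear ⟩
  260 * m * Y           ≡⟨ xy∙z≈xz∙y 260 m Y ⟩
  260 * Y * m           ∎)
  where
  X = suc (5 + m) ^ 5
  Y = (5 + m) ^ 5
  linear : 256 * (5 + m) ≤ 260 * m
  linear = subst₂ _≤_ (sym (split₁ m)) (sym (split₂ m)) (+-monoˡ-≤ (256 * m) (*-monoʳ-≤ 4 320≤m))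
    where
    split₁ : ∀ m → 256 * (5 + m) ≡ 4 * 320 + 256 * m
    split₁ = solve-∀
    split₂ : ∀ m → 260 * m ≡ 4 * m + 256 * m
    split₂ = solve-∀

2*[d+2]^5*256^d≤260^d : ∀ d → 3000 ≤ d → 2 * (d + 2) ^ 5 * 256 ^ d ≤ 260 ^ d
2*[d+2]^5*256^d≤260^d d 3000≤d = subst Bound (m+[n∸m]≡n 3000≤d) (from-3000 (d ∸ 3000))
  where
  Bound : ℕ → Set
  Bound d = 2 * (d + 2) ^ 5 * 256 ^ d ≤ 260 ^ d
  step : ∀ d → 323 ≤ d → Bound d → Bound (suc d)
  step d 323≤d IH = begin
    2 * (suc d + 2) ^ 5 * (256 * 256 ^ d)   ≡⟨ shuffle₁ ((suc d + 2) ^ 5) (256 ^ d) ⟩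
    2 * 256 ^ d * (256 * (suc d + 2) ^ 5)   ≤⟨ *-monoʳ-≤ (2 * 256 ^ d) ratio ⟩
    2 * 256 ^ d * (260 * (d + 2) ^ 5)       ≡⟨ shuffle₂ ((d + 2) ^ 5) (256 ^ d) ⟩
    260 * (2 * (d + 2) ^ 5 * 256 ^ d)       ≤⟨ *-monoʳ-≤ 260 IH ⟩
    260 * 260 ^ d                           ∎
    where
    ratio : 256 * (suc d + 2) ^ 5 ≤ 260 * (d + 2) ^ 5
    ratio = subst (λ x → 256 * suc x ^ 5 ≤ 260 * x ^ 5) 5+[d∸3]≡d+2
                  (256*[6+m]^5≤260*[5+m]^5 (d ∸ 3) (∸-monoˡ-≤ 3 323≤d))
      where
      5+[d∸3]≡d+2 : 5 + (d ∸ 3) ≡ d + 2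
      5+[d∸3]≡d+2 = trans (cong (2 +_) (m+[n∸m]≡n (≤-trans (≤ᵇ⇒≤ 3 323 _) 323≤d))) (+-comm 2 d)
    shuffle₁ : ∀ a c → 2 * a * (256 * c) ≡ 2 * c * (256 * a)
    shuffle₁ = solve-∀
    shuffle₂ : ∀ y c → 2 * c * (260 * y) ≡ 260 * (2 * y * c)
    shuffle₂ = solve-∀
  from-3000 : ∀ j → Bound (3000 + j)
  from-3000 zero    = ≤ᵇ⇒≤ _ _ _
  from-3000 (suc j) = subst Bound (sym (+-suc 3000 j))
                            (step (3000 + j) (≤-trans (≤ᵇ⇒≤ 323 3000 _) (m≤m+n 3000 j)) (from-3000 j))

expBound≤260^d : ∀ d → 3000 ≤ d → expBound d ≤ 260 ^ d
expBound≤260^d d 3000≤d = ≤-trans (*-monoˡ-≤ (256 ^ d) polynomial-part) (2*[d+2]^5*256^d≤260^d d 3000≤d)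
  where
  polynomial-part : (2 * d + 3) * suc d ^ 4 ≤ 2 * (d + 2) ^ 5
  polynomial-part = begin
    (2 * d + 3) * suc d ^ 4          ≤⟨ *-mono-≤ (+-monoʳ-≤ (2 * d) (n≤1+n 3)) (^-monoˡ-≤ 4 (≤-reflexive (+-comm 1 d))) ⟩
    (2 * d + 4) * (d + 1) ^ 4        ≤⟨ *-monoʳ-≤ (2 * d + 4) (^-monoˡ-≤ 4 (+-monoʳ-≤ d (n≤1+n 1))) ⟩
    (2 * d + 4) * (d + 2) ^ 4        ≡⟨ cong (_* (d + 2) ^ 4) (*-distribˡ-+ 2 d 2) ⟨
    2 * (d + 2) * (d + 2) ^ 4        ≡⟨ *-assoc 2 (d + 2) ((d + 2) ^ 4) ⟩
    2 * (d + 2) ^ 5                  ∎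

bernoulli₂ : ∀ a n → a ^ n * (2 * (a * a) + 2 * n * a + n * n) ≤ 2 * (a * a) * suc a ^ n + a ^ n * n
bernoulli₂ a zero = ≤-reflexive (base a)
  where
  base : ∀ a → 1 * (2 * (a * a) + 2 * 0 * a + 0 * 0) ≡ 2 * (a * a) * 1 + 1 * 0
  base = solve-∀
bernoulli₂ a (suc n) = +-cancelʳ-≤ E _ _ (begin
  a * P * (2 * (a * a) + 2 * suc n * a + suc n * suc n) + E   ≡⟨ expand₁ a P n ⟩
  P * (K + n)                                                 ≤⟨ *-monoʳ-≤ P (+-monoʳ-≤ K (m≤m*m n)) ⟩
  P * (K + n * n)                                             ≡⟨ expand₂ a P n ⟨
  suc a * P * (2 * (a * a) + 2 * n * a + n * n) + a * P * suc n   ≡⟨ cong (_+ a * P * suc n) (*-assoc (suc a) P _) ⟩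
  suc a * (P * (2 * (a * a) + 2 * n * a + n * n)) + a * P * suc n ≤⟨ +-monoˡ-≤ (a * P * suc n) (*-monoʳ-≤ (suc a) (bernoulli₂ a n)) ⟩
  suc a * (2 * (a * a) * Q + P * n) + a * P * suc n           ≡⟨ collect a P n Q ⟩
  2 * (a * a) * (suc a * Q) + a * P * suc n + E               ∎)
  where
  P = a ^ n
  Q = suc a ^ n
  E = suc a * P * n
  K = 2 * (a * a * a) + 2 * n * (a * a) + 2 * (a * a) + n * n * a + 3 * n * a + a
  m≤m*m : ∀ m → m ≤ m * m
  m≤m*m zero    = z≤n
  m≤m*m (suc m) = m≤m*n (suc m) (suc m)
  expand₁ : ∀ a p n → a * p * (2 * (a * a) + 2 * suc n * a + suc n * suc n) + suc a * p * n
                    ≡ p * (2 * (a * a * a) + 2 * n * (a * a) + 2 * (a * a) + n * n * a + 3 * n * a + a + n)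
  expand₁ = solve-∀
  expand₂ : ∀ a p n → suc a * p * (2 * (a * a) + 2 * n * a + n * n) + a * p * suc n
                    ≡ p * (2 * (a * a * a) + 2 * n * (a * a) + 2 * (a * a) + n * n * a + 3 * n * a + a + n * n)
  expand₂ = solve-∀
  collect : ∀ a p n q → suc a * (2 * (a * a) * q + p * n) + a * p * suc n
                      ≡ 2 * (a * a) * (suc a * q) + a * p * suc n + suc a * p * n
  collect = solve-∀

5*a^[1+a]≤2*[1+a]^[1+a] : ∀ a → 1 ≤ a → 5 * a ^ suc a ≤ 2 * suc a ^ suc a
5*a^[1+a]≤2*[1+a]^[1+a] a@(suc _) _ = *-cancelˡ-≤ (a * a) (begin
  a * a * (5 * P)                          ≡⟨ reorder a P ⟩
  P * (5 * (a * a))                        ≤⟨ *-monoʳ-≤ P (m≤m+n (5 * (a * a)) (3 * a)) ⟩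
  P * (5 * (a * a) + 3 * a)                ≤⟨ +-cancelʳ-≤ (P * suc a) _ _ (≤-trans (≤-reflexive (sym (expand a P)))
                                                                                    (bernoulli₂ a (suc a))) ⟩
  2 * (a * a) * suc a ^ suc a              ≡⟨ xy∙z≈y∙xz 2 (a * a) (suc a ^ suc a) ⟩
  a * a * (2 * suc a ^ suc a)              ∎)
  where
  P = a ^ suc a
  reorder : ∀ a p → a * a * (5 * p) ≡ p * (5 * (a * a))
  reorder = solve-∀
  expand : ∀ a p → p * (2 * (a * a) + 2 * suc a * a + suc a * suc a) ≡ p * (5 * (a * a) + 3 * a) + p * suc a
  expand = solve-∀

-- Abstract, so that conversion checking never unfolds these large literals in unary.
abstract
  α β : ℕ
  α = 16 * 260 ^ 3
  β = 625 * 81 ^ 3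

  α≡16*260³ : α ≡ 16 * (260 * 260 * 260)
  α≡16*260³ = refl

  β≡625*81³ : β ≡ 625 * (81 * 81 * 81)
  β≡625*81³ = refl

  α≤β : α ≤ β
  α≤β = ≤ᵇ⇒≤ α β _

  α*8≤[β∸α]*45 : α * 8 ≤ (β ∸ α) * 45
  α*8≤[β∸α]*45 = ≤ᵇ⇒≤ (α * 8) ((β ∸ α) * 45) _

α*[9+m]^8≤β*[8+m]^8 : ∀ m → 45 ≤ m → α * suc (8 + m) ^ 8 ≤ β * (8 + m) ^ 8
α*[9+m]^8≤β*[8+m]^8 m@(suc _) 45≤m = *-cancelʳ-≤ _ _ m (begin
  α * X * m           ≡⟨ *-assoc α X m ⟩
  α * (X * m)         ≤⟨ *-monoʳ-≤ α (suc[k+m]^k*m≤[k+m]^suc[k] 8 m) ⟩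
  α * ((8 + m) * Y)   ≡⟨ x∙yz≈xy∙z α (8 + m) Y ⟩
  α * (8 + m) * Y     ≤⟨ *-monoˡ-≤ Y linear ⟩
  β * m * Y           ≡⟨ xy∙z≈xz∙y β m Y ⟩
  β * Y * m           ∎)
  where
  X = suc (8 + m) ^ 8
  Y = (8 + m) ^ 8
  linear : α * (8 + m) ≤ β * m
  linear = begin
    α * (8 + m)             ≡⟨ *-distribˡ-+ α 8 m ⟩
    α * 8 + α * m           ≤⟨ +-monoˡ-≤ (α * m) α*8≤[β∸α]*45 ⟩
    (β ∸ α) * 45 + α * m    ≤⟨ +-monoˡ-≤ (α * m) (*-monoʳ-≤ (β ∸ α) 45≤m) ⟩
    (β ∸ α) * m + α * m     ≡⟨ *-distribʳ-+ m (β ∸ α) α ⟨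
    (β ∸ α + α) * m         ≡⟨ cong (_* m) (m∸n+n≡m α≤β) ⟩
    β * m                   ∎

256*[1+q]^8*16^q*[260^[1+q]]³≤625^q*[81^[1+q]]³ : ∀ q → 400 ≤ q →
  256 * suc q ^ 8 * 16 ^ q * (260 ^ suc q * 260 ^ suc q * 260 ^ suc q) ≤ 625 ^ q * (81 ^ suc q * 81 ^ suc q * 81 ^ suc q)
256*[1+q]^8*16^q*[260^[1+q]]³≤625^q*[81^[1+q]]³ q 400≤q = subst Bound (m+[n∸m]≡n 400≤q) (from-400 (q ∸ 400))
  where
  Bound : ℕ → Set
  Bound q = 256 * suc q ^ 8 * 16 ^ q * (260 ^ suc q * 260 ^ suc q * 260 ^ suc q)
          ≤ 625 ^ q * (81 ^ suc q * 81 ^ suc q * 81 ^ suc q)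
  step : ∀ q → 52 ≤ q → Bound q → Bound (suc q)
  step q 52≤q IH = begin
    256 * S′ * (16 * P) * (260 * U * (260 * U) * (260 * U))   ≡⟨ split-α α 260 S′ P U α≡16*260³ ⟩
    α * S′ * (256 * P * (U * U * U))                          ≤⟨ *-monoˡ-≤ (256 * P * (U * U * U)) ratio ⟩
    β * S * (256 * P * (U * U * U))                           ≡⟨ regroup β S P (U * U * U) ⟩
    β * (256 * S * P * (U * U * U))                           ≤⟨ *-monoʳ-≤ β IH ⟩
    β * (625 ^ q * (V * V * V))                               ≡⟨ merge-β β 81 (625 ^ q) V β≡625*81³ ⟩
    625 * 625 ^ q * (81 * V * (81 * V) * (81 * V))            ∎
    where
    S = suc q ^ 8
    S′ = suc (suc q) ^ 8
    P = 16 ^ q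
    U = 260 ^ suc q
    V = 81 ^ suc q
    ratio : α * S′ ≤ β * S
    ratio = subst (λ x → α * suc x ^ 8 ≤ β * x ^ 8) (cong suc (m+[n∸m]≡n (≤-trans (≤ᵇ⇒≤ 7 52 _) 52≤q)))
                  (α*[9+m]^8≤β*[8+m]^8 (q ∸ 7) (∸-monoˡ-≤ 7 52≤q))
    split-α : ∀ a c s p u → a ≡ 16 * (c * c * c) →
              256 * s * (16 * p) * (c * u * (c * u) * (c * u)) ≡ a * s * (256 * p * (u * u * u))
    split-α a c s p u refl = solve-∀′ c s p u
      where
      solve-∀′ : ∀ c s p u → 256 * s * (16 * p) * (c * u * (c * u) * (c * u)) ≡ 16 * (c * c * c) * s * (256 * p * (u * u * u))
      solve-∀′ = solve-∀
    regroup : ∀ b s p w → b * s * (256 * p * w) ≡ b * (256 * s * p * w)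
    regroup = solve-∀
    merge-β : ∀ b c r v → b ≡ 625 * (c * c * c) → b * (r * (v * v * v)) ≡ 625 * r * (c * v * (c * v) * (c * v))
    merge-β b c r v refl = solve-∀′ c r v
      where
      solve-∀′ : ∀ c r v → 625 * (c * c * c) * (r * (v * v * v)) ≡ 625 * r * (c * v * (c * v) * (c * v))
      solve-∀′ = solve-∀
  from-400 : ∀ j → Bound (400 + j)
  from-400 zero    = ≤ᵇ⇒≤ _ _ _
  from-400 (suc j) = subst Bound (sym (+-suc 400 j))
                           (step (400 + j) (≤-trans (≤ᵇ⇒≤ 52 400 _) (m≤m+n 400 j)) (from-400 j))

a^[r+q[1+a]]*5^q≤2^q*[1+a]^[r+q[1+a]] : ∀ a q r → 1 ≤ a → a ^ (r + q * suc a) * 5 ^ q ≤ 2 ^ q * suc a ^ (r + q * suc a)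
a^[r+q[1+a]]*5^q≤2^q*[1+a]^[r+q[1+a]] a q r 1≤a = begin
  a ^ (r + q * t) * 5 ^ q          ≡⟨ cong (_* 5 ^ q) (^-distribˡ-+-* a r (q * t)) ⟩
  a ^ r * a ^ (q * t) * 5 ^ q      ≡⟨ xy∙z≈x∙zy (a ^ r) (a ^ (q * t)) (5 ^ q) ⟩
  a ^ r * (5 ^ q * a ^ (q * t))    ≡⟨ cong (λ x → a ^ r * (5 ^ q * x)) (^-swap a) ⟩
  a ^ r * (5 ^ q * (a ^ t) ^ q)    ≡⟨ cong (a ^ r *_) (^-distribʳ-* 5 (a ^ t) q) ⟨
  a ^ r * (5 * a ^ t) ^ q          ≤⟨ *-mono-≤ (^-monoˡ-≤ r (n≤1+n a)) (^-monoˡ-≤ q (5*a^[1+a]≤2*[1+a]^[1+a] a 1≤a)) ⟩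
  t ^ r * (2 * t ^ t) ^ q          ≡⟨ cong (t ^ r *_) (^-distribʳ-* 2 (t ^ t) q) ⟩
  t ^ r * (2 ^ q * (t ^ t) ^ q)    ≡⟨ x∙yz≈y∙xz (t ^ r) (2 ^ q) ((t ^ t) ^ q) ⟩
  2 ^ q * (t ^ r * (t ^ t) ^ q)    ≡⟨ cong (λ x → 2 ^ q * (t ^ r * x)) (^-swap t) ⟨
  2 ^ q * (t ^ r * t ^ (q * t))    ≡⟨ cong (2 ^ q *_) (^-distribˡ-+-* t r (q * t)) ⟨
  2 ^ q * t ^ (r + q * t)          ∎
  where
  t = suc a
  ^-swap : ∀ x → x ^ (q * t) ≡ (x ^ t) ^ q
  ^-swap x = trans (cong (x ^_) (*-comm q t)) (sym (^-*-assoc x t q))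

X*81^d≤260^d-mono : ∀ X {d e} → d ≤ e → X * 81 ^ d ≤ 260 ^ d → X * 81 ^ e ≤ 260 ^ e
X*81^d≤260^d-mono X {d} d≤e h with m≤n⇒∃[o]m+o≡n d≤e
... | j , refl = begin
  X * 81 ^ (d + j)           ≡⟨ cong (X *_) (^-distribˡ-+-* 81 d j) ⟩
  X * (81 ^ d * 81 ^ j)      ≡⟨ *-assoc X (81 ^ d) (81 ^ j) ⟨
  X * 81 ^ d * 81 ^ j        ≤⟨ *-monoˡ-≤ (81 ^ j) h ⟩
  260 ^ d * 81 ^ j           ≤⟨ *-monoʳ-≤ (260 ^ d) (^-monoˡ-≤ j (≤ᵇ⇒≤ 81 260 _)) ⟩
  260 ^ d * 260 ^ j          ≡⟨ ^-distribˡ-+-* 260 d j ⟨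
  260 ^ (d + j)              ∎

t^[4t]*81^[st]≤260^[st]⇒t^4*81^s≤260^s : ∀ t s → 1 ≤ t →
  t ^ (4 * t) * 81 ^ (s * t) ≤ 260 ^ (s * t) → t ^ 4 * 81 ^ s ≤ 260 ^ s
t^[4t]*81^[st]≤260^[st]⇒t^4*81^s≤260^s t@(suc t-1) s _ h = ^-cancelʳ-≤ t-1 (begin
  (t ^ 4 * 81 ^ s) ^ t           ≡⟨ ^-distribʳ-* (t ^ 4) (81 ^ s) t ⟩
  (t ^ 4) ^ t * (81 ^ s) ^ t     ≡⟨ cong₂ _*_ (^-*-assoc t 4 t) (^-*-assoc 81 s t) ⟩
  t ^ (4 * t) * 81 ^ (s * t)     ≤⟨ h ⟩
  260 ^ (s * t)                  ≡⟨ ^-*-assoc 260 s t ⟨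
  (260 ^ s) ^ t                  ∎)

X≤4t³[1+q]²⇒X*2^q≤5^q : ∀ t q X → 400 ≤ q → X ≤ 4 * (t * t * t) * (suc q * suc q) →
  t ^ 4 * 81 ^ suc q ≤ 260 ^ suc q → X * 2 ^ q ≤ 5 ^ q
X≤4t³[1+q]²⇒X*2^q≤5^q t q X 400≤q X≤ h = ^-cancelʳ-≤ 3 (begin
  (X * 2 ^ q) ^ 4     ≡⟨ ^-distribʳ-* X (2 ^ q) 4 ⟩
  X ^ 4 * (2 ^ q) ^ 4 ≡⟨ cong (X ^ 4 *_) (^-swap 2) ⟩
  X ^ 4 * 16 ^ q      ≤⟨ fourth-powers ⟩
  625 ^ q             ≡⟨ ^-swap 5 ⟨
  (5 ^ q) ^ 4         ∎)
  where
  s = suc q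
  V = 81 ^ s
  U = 260 ^ s
  ^-swap : ∀ x → (x ^ q) ^ 4 ≡ (x ^ 4) ^ q
  ^-swap x = trans (^-*-assoc x q 4) (trans (cong (x ^_) (*-comm q 4)) (sym (^-*-assoc x 4 q)))
  fourth-powers : X ^ 4 * 16 ^ q ≤ 625 ^ q
  fourth-powers = *-cancelʳ-≤ _ _ (V * V * V) {{V³≢0}} (begin
    X ^ 4 * 16 ^ q * (V * V * V)                          ≤⟨ *-monoˡ-≤ (V * V * V) (*-monoˡ-≤ (16 ^ q) (^-monoˡ-≤ 4 X≤)) ⟩
    (4 * (t * t * t) * (s * s)) ^ 4 * 16 ^ q * (V * V * V) ≡⟨ regroup t s (16 ^ q) V ⟩
    256 * s ^ 8 * 16 ^ q * (t ^ 4 * V * (t ^ 4 * V) * (t ^ 4 * V))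
                                                          ≤⟨ *-monoʳ-≤ (256 * s ^ 8 * 16 ^ q) (*-mono-≤ (*-mono-≤ h h) h) ⟩
    256 * s ^ 8 * 16 ^ q * (U * U * U)                    ≤⟨ 256*[1+q]^8*16^q*[260^[1+q]]³≤625^q*[81^[1+q]]³ q 400≤q ⟩
    625 ^ q * (V * V * V)                                 ∎)
    where
    V³≢0 : NonZero (V * V * V)
    V³≢0 = m*n≢0 (V * V) V {{m*n≢0 V V {{m^n≢0 81 s}} {{m^n≢0 81 s}}}} {{m^n≢0 81 s}}
    regroup : ∀ t s a v → let y = 4 * (t * t * t) * (s * s) ; t⁴ = t * (t * (t * (t * 1))) in
      y * (y * (y * (y * 1))) * a * (v * v * v)
      ≡ 256 * (s * (s * (s * (s * (s * (s * (s * (s * 1)))))))) * a * (t⁴ * v * (t⁴ * v) * (t⁴ * v))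
    regroup = solve-∀

abstract
  T₀ : ℕ
  T₀ = suc (expBound 3000 + 260 ^ 401)

  expBound[3000]<T₀ : expBound 3000 < T₀
  expBound[3000]<T₀ = s≤s (m≤m+n (expBound 3000) (260 ^ 401))

  260^401<T₀ : 260 ^ 401 < T₀
  260^401<T₀ = s≤s (m≤n+m (260 ^ 401) (expBound 3000))

2≤T₀ : 2 ≤ T₀
2≤T₀ = ≤-trans (≤ᵇ⇒≤ 2 (suc (260 ^ 401)) _) 260^401<T₀

module _ {t d : ℕ} (T₀≤t : T₀ ≤ t) (4tlnt≤d : FourTLnTLe t d) where

  private
    1≤t : 1 ≤ t
    1≤t = ≤-trans (s≤s z≤n) (≤-trans 2≤T₀ T₀≤t)

    t^[4t]*81^d≤expBound[d] : t ^ (4 * t) * 81 ^ d ≤ expBound d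
    t^[4t]*81^d≤expBound[d] = X*m!≤expSum⇒X*81^d≤expBound (t ^ (4 * t)) d (proj₁ 4tlnt≤d) (proj₂ 4tlnt≤d)

  3000≤d : 3000 ≤ d
  3000≤d with 3000 ≤? d
  ... | yes 3000≤d = 3000≤d
  ... | no  3000≰d = ⊥-elim (<⇒≱ (≤-trans expBound[3000]<T₀ T₀≤t) (begin
    t                          ≤⟨ m≤m^n t (4 * t) 1≤t (≤-trans 1≤t (m≤m+n t _)) ⟩
    t ^ (4 * t)                ≤⟨ m≤m*n (t ^ (4 * t)) (81 ^ d) {{m^n≢0 81 d}} ⟩
    t ^ (4 * t) * 81 ^ d       ≤⟨ t^[4t]*81^d≤expBound[d] ⟩
    expBound d                 ≤⟨ expBound-mono (<⇒≤ (≰⇒> 3000≰d)) ⟩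
    expBound 3000              ∎))

  private
    instance
      t≢0 : NonZero t
      t≢0 = >-nonZero 1≤t

    q = d / t

    d≡d%t+qt : d ≡ d % t + q * t
    d≡d%t+qt = m≡m%n+[m/n]*n d t

    d≤[1+q]t : d ≤ suc q * t
    d≤[1+q]t = subst (_≤ suc q * t) (sym d≡d%t+qt) (+-monoˡ-≤ (q * t) (<⇒≤ (m%n<n d t)))

    t^4*81^[1+q]≤260^[1+q] : t ^ 4 * 81 ^ suc q ≤ 260 ^ suc q
    t^4*81^[1+q]≤260^[1+q] = t^[4t]*81^[st]≤260^[st]⇒t^4*81^s≤260^s t (suc q) 1≤t
      (X*81^d≤260^d-mono (t ^ (4 * t)) d≤[1+q]t (≤-trans t^[4t]*81^d≤expBound[d] (expBound≤260^d d 3000≤d)))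

    400≤q : 400 ≤ q
    400≤q with 400 ≤? q
    ... | yes 400≤q = 400≤q
    ... | no  400≰q = ⊥-elim (<⇒≱ (≤-trans 260^401<T₀ T₀≤t) (begin
      t                          ≤⟨ m≤m^n t 4 1≤t (s≤s z≤n) ⟩
      t ^ 4                      ≤⟨ m≤m*n (t ^ 4) (81 ^ suc q) {{m^n≢0 81 (suc q)}} ⟩
      t ^ 4 * 81 ^ suc q         ≤⟨ t^4*81^[1+q]≤260^[1+q] ⟩
      260 ^ suc q                ≤⟨ ^-monoʳ-≤ 260 (≤-trans (≰⇒> 400≰q) (n≤1+n 400)) ⟩
      260 ^ 401                  ∎))

    4d²t≤4t³[1+q]² : 4 * (d * d) * t ≤ 4 * (t * t * t) * (suc q * suc q)
    4d²t≤4t³[1+q]² = begin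
      4 * (d * d) * t                      ≤⟨ *-monoˡ-≤ t (*-monoʳ-≤ 4 (*-mono-≤ d≤[1+q]t d≤[1+q]t)) ⟩
      4 * (suc q * t * (suc q * t)) * t    ≡⟨ shuffle (suc q) t ⟩
      4 * (t * t * t) * (suc q * suc q)    ∎
      where
      shuffle : ∀ s t → 4 * (s * t * (s * t)) * t ≡ 4 * (t * t * t) * (s * s)
      shuffle = solve-∀

  -- With q = ⌊d/t⌋: (t/(t-1))^d ≥ (5/2)^q, while 4 d² t ≤ 4 t³ (q+1)² and t^4 ≤ (260/81)^(q+1).
  4d²t[t∸1]^d≤t^d : 4 * (d * d) * t * (t ∸ 1) ^ d ≤ t ^ d
  4d²t[t∸1]^d≤t^d with ≤-trans 2≤T₀ T₀≤t
  ... | s≤s {n = a} 1≤a = *-cancelʳ-≤ _ _ (5 ^ q) {{m^n≢0 5 q}} (begin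
    X * a ^ d * 5 ^ q           ≡⟨ *-assoc X (a ^ d) (5 ^ q) ⟩
    X * (a ^ d * 5 ^ q)         ≤⟨ *-monoʳ-≤ X (subst (λ x → a ^ x * 5 ^ q ≤ 2 ^ q * t ^ x) (sym d≡d%t+qt)
                                     (a^[r+q[1+a]]*5^q≤2^q*[1+a]^[r+q[1+a]] a q (d % t) 1≤a)) ⟩
    X * (2 ^ q * t ^ d)         ≡⟨ x∙yz≈xy∙z X (2 ^ q) (t ^ d) ⟩
    X * 2 ^ q * t ^ d           ≤⟨ *-monoˡ-≤ (t ^ d) (X≤4t³[1+q]²⇒X*2^q≤5^q t q X 400≤q 4d²t≤4t³[1+q]² t^4*81^[1+q]≤260^[1+q]) ⟩
    5 ^ q * t ^ d               ≡⟨ *-comm (5 ^ q) (t ^ d) ⟩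
    t ^ d * 5 ^ q               ∎)
    where
    X = 4 * (d * d) * t

𝟙 : Bool → ℕ
𝟙 true  = 1
𝟙 false = 0

𝟙≤1 : ∀ b → 𝟙 b ≤ 1
𝟙≤1 true  = ≤-refl
𝟙≤1 false = z≤n

𝟙-mono : ∀ {a b} → (a ≡ true → b ≡ true) → 𝟙 a ≤ 𝟙 b
𝟙-mono {false} _   = z≤n
𝟙-mono {true}  a⇒b rewrite a⇒b refl = ≤-refl

0<𝟙⇒≡true : ∀ {b} → 0 < 𝟙 b → b ≡ true
0<𝟙⇒≡true {true} _ = refl

𝟙-∧ : ∀ a b → 𝟙 (a ∧ b) ≡ 𝟙 a * 𝟙 b
𝟙-∧ true  b = sym (+-identityʳ (𝟙 b))
𝟙-∧ false b = refl

𝟙-not+𝟙 : ∀ b → 𝟙 (not b) + 𝟙 b ≡ 1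
𝟙-not+𝟙 true  = refl
𝟙-not+𝟙 false = refl

∑-mono-≤ : ∀ {k} {f g : Fin k → ℕ} → (∀ i → f i ≤ g i) → sum f ≤ sum g
∑-mono-≤ {zero}  _   = z≤n
∑-mono-≤ {suc k} f≤g = +-mono-≤ (f≤g zero) (∑-mono-≤ (f≤g ∘ suc))

∑-mono-< : ∀ {k} {f g : Fin k → ℕ} → (∀ i → f i ≤ g i) → ∀ j → f j < g j → sum f < sum g
∑-mono-< {suc k} f≤g zero    fj<gj = +-mono-<-≤ fj<gj (∑-mono-≤ (f≤g ∘ suc))
∑-mono-< {suc k} f≤g (suc j) fj<gj = +-mono-≤-< (f≤g zero) (∑-mono-< (f≤g ∘ suc) j fj<gj)

∑-const : ∀ k c → ∑[ i < k ] c ≡ k * c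
∑-const zero    c = refl
∑-const (suc k) c = cong (c +_) (∑-const k c)

f[i]≤∑f : ∀ {k} (f : Fin k → ℕ) i → f i ≤ sum f
f[i]≤∑f f zero    = m≤m+n (f zero) _
f[i]≤∑f f (suc i) = ≤-trans (f[i]≤∑f (f ∘ suc) i) (m≤n+m _ (f zero))

0<∑⇒∃0< : ∀ {k} (f : Fin k → ℕ) → 0 < sum f → ∃ λ i → 0 < f i
0<∑⇒∃0< {suc k} f 0<∑f with f zero in eq
... | suc _ = zero , subst (0 <_) (sym eq) z<s
... | zero with 0<∑⇒∃0< (f ∘ suc) 0<∑f
...   | i , 0<fi = suc i , 0<fi

∑[f*g]*k≡∑f*∑g : ∀ k (f g : Fin k → ℕ) → (∀ i j → g i ≡ g j) → ∑[ i < k ] (f i * g i) * k ≡ sum f * sum g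
∑[f*g]*k≡∑f*∑g k f g g-const = begin-equality
  ∑[ i < k ] (f i * g i) * k   ≡⟨ *-distribʳ-sum {k} k (λ i → f i * g i) ⟩
  ∑[ i < k ] (f i * g i * k)   ≡⟨ sum-cong-≗ {k} (λ i → trans (*-assoc (f i) (g i) k) (cong (f i *_) (g[i]*k≡∑g i))) ⟩
  ∑[ i < k ] (f i * sum g)     ≡⟨ *-distribʳ-sum {k} (sum g) f ⟨
  sum f * sum g                ∎
  where
  g[i]*k≡∑g : ∀ i → g i * k ≡ sum g
  g[i]*k≡∑g i = sym (trans (sum-cong-≗ {k} (λ j → g-const j i)) (trans (∑-const k (g i)) (*-comm k (g i))))

_==_ : ∀ {k} → Fin k → Fin k → Bool
i == j = does (i ≟ᶠ j)

==⇒≡ : ∀ {k} {i j : Fin k} → i == j ≡ true → i ≡ j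
==⇒≡ {i = i} {j} h with i ≟ᶠ j
... | yes i≡j = i≡j

==-refl : ∀ {k} (i : Fin k) → i == i ≡ true
==-refl i = dec-true (i ≟ᶠ i) refl

∑-δ : ∀ {k} (f : Fin k → ℕ) j → ∑[ i < k ] (𝟙 (i == j) * f i) ≡ f j
∑-δ {suc k} f zero    = trans (cong (f zero + 0 +_) (sum-replicate-zero k)) (trans (+-identityʳ _) (+-identityʳ _))
∑-δ {suc k} f (suc j) = ∑-δ (f ∘ suc) j

∏ : ∀ k → (Fin k → ℕ) → ℕ
∏ zero    f = 1
∏ (suc k) f = f zero * ∏ k (f ∘ suc)

∏-cong : ∀ k {f g : Fin k → ℕ} → (∀ i → f i ≡ g i) → ∏ k f ≡ ∏ k g
∏-cong zero    _   = refl
∏-cong (suc k) f≗g = cong₂ _*_ (f≗g zero) (∏-cong k (f≗g ∘ suc))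

anyᶠ : ∀ k → (Fin k → Bool) → Bool
anyᶠ zero    P = false
anyᶠ (suc k) P = P zero ∨ anyᶠ k (P ∘ suc)

allᶠ : ∀ k → (Fin k → Bool) → Bool
allᶠ zero    P = true
allᶠ (suc k) P = P zero ∧ allᶠ k (P ∘ suc)

anyᶠ⇒∃ : ∀ {k} {P : Fin k → Bool} → anyᶠ k P ≡ true → ∃ λ i → P i ≡ true
anyᶠ⇒∃ {suc k} {P} h with P zero in eq
... | true  = zero , eq
... | false with anyᶠ⇒∃ h
...   | i , Pi = suc i , Pi

∃⇒anyᶠ : ∀ {k} {P : Fin k → Bool} i → P i ≡ true → anyᶠ k P ≡ true
∃⇒anyᶠ {P = P} zero    Pi rewrite Pi = refl
∃⇒anyᶠ {P = P} (suc i) Pi with P zero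
... | true  = refl
... | false = ∃⇒anyᶠ i Pi

¬anyᶠ⇒∀ : ∀ {k} {P : Fin k → Bool} → anyᶠ k P ≡ false → ∀ i → P i ≡ false
¬anyᶠ⇒∀ {suc k} {P} h zero    = ∨-conicalˡ (P zero) _ h
¬anyᶠ⇒∀ {suc k} {P} h (suc i) = ¬anyᶠ⇒∀ (∨-conicalʳ (P zero) _ h) i

allᶠ⇒∀ : ∀ {k} {P : Fin k → Bool} → allᶠ k P ≡ true → ∀ i → P i ≡ true
allᶠ⇒∀ {suc k} {P} h zero    = ∧-conicalˡ (P zero) _ h
allᶠ⇒∀ {suc k} {P} h (suc i) = allᶠ⇒∀ (∧-conicalʳ (P zero) _ h) i

∀⇒allᶠ : ∀ {k} {P : Fin k → Bool} → (∀ i → P i ≡ true) → allᶠ k P ≡ true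
∀⇒allᶠ {zero}      _  = refl
∀⇒allᶠ {suc k} {P} ∀P rewrite ∀P zero = ∀⇒allᶠ (∀P ∘ suc)

¬allᶠ⇒∃ : ∀ {k} {P : Fin k → Bool} → allᶠ k P ≡ false → ∃ λ i → P i ≡ false
¬allᶠ⇒∃ {suc k} {P} h with P zero in eq
... | false = zero , eq
... | true with ¬allᶠ⇒∃ h
...   | i , Pi = suc i , Pi

anyᶠ-cong : ∀ k {P Q : Fin k → Bool} → (∀ i → P i ≡ Q i) → anyᶠ k P ≡ anyᶠ k Q
anyᶠ-cong zero    _   = refl
anyᶠ-cong (suc k) P≗Q = cong₂ _∨_ (P≗Q zero) (anyᶠ-cong k (P≗Q ∘ suc))

allᶠ-cong : ∀ k {P Q : Fin k → Bool} → (∀ i → P i ≡ Q i) → allᶠ k P ≡ allᶠ k Q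
allᶠ-cong zero    _   = refl
allᶠ-cong (suc k) P≗Q = cong₂ _∧_ (P≗Q zero) (allᶠ-cong k (P≗Q ∘ suc))

𝟙-anyᶠ≤∑ : ∀ k P → 𝟙 (anyᶠ k P) ≤ ∑[ i < k ] 𝟙 (P i)
𝟙-anyᶠ≤∑ zero    P = z≤n
𝟙-anyᶠ≤∑ (suc k) P with P zero
... | true  = s≤s z≤n
... | false = 𝟙-anyᶠ≤∑ k (P ∘ suc)

𝟙-not-allᶠ≤∑ : ∀ k P → 𝟙 (not (allᶠ k P)) ≤ ∑[ i < k ] 𝟙 (not (P i))
𝟙-not-allᶠ≤∑ zero    P = z≤n
𝟙-not-allᶠ≤∑ (suc k) P with P zero
... | true  = 𝟙-not-allᶠ≤∑ k (P ∘ suc)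
... | false = s≤s z≤n

𝟙-not-anyᶠ≡∏ : ∀ k P → 𝟙 (not (anyᶠ k P)) ≡ ∏ k (λ i → 𝟙 (not (P i)))
𝟙-not-anyᶠ≡∏ zero    P = refl
𝟙-not-anyᶠ≡∏ (suc k) P with P zero
... | true  = refl
... | false = trans (𝟙-not-anyᶠ≡∏ k (P ∘ suc)) (sym (+-identityʳ _))

module Colourings (t : ℕ) where

  Colouring : ℕ → Set
  Colouring n = Fin n → Fin t

  infixr 5 _∷ᶜ_
  _∷ᶜ_ : ∀ {n} → Fin t → Colouring n → Colouring (suc n)
  (c ∷ᶜ ω) zero    = c
  (c ∷ᶜ ω) (suc i) = ω i

  ∑ᶜ : ∀ n → (Colouring n → ℕ) → ℕ
  ∑ᶜ zero    f = f (λ ())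
  ∑ᶜ (suc n) f = ∑[ c < t ] ∑ᶜ n (λ ω → f (c ∷ᶜ ω))

  ∑ᶜ-mono-≤ : ∀ n {f g : Colouring n → ℕ} → (∀ ω → f ω ≤ g ω) → ∑ᶜ n f ≤ ∑ᶜ n g
  ∑ᶜ-mono-≤ zero    f≤g = f≤g _
  ∑ᶜ-mono-≤ (suc n) f≤g = ∑-mono-≤ (λ c → ∑ᶜ-mono-≤ n (λ ω → f≤g (c ∷ᶜ ω)))

  ∑ᶜ-cong : ∀ n {f g : Colouring n → ℕ} → (∀ ω → f ω ≡ g ω) → ∑ᶜ n f ≡ ∑ᶜ n g
  ∑ᶜ-cong zero    f≗g = f≗g _
  ∑ᶜ-cong (suc n) f≗g = sum-cong-≗ {t} (λ c → ∑ᶜ-cong n (λ ω → f≗g (c ∷ᶜ ω)))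

  ∑ᶜ-distrib-+ : ∀ n (f g : Colouring n → ℕ) → ∑ᶜ n (λ ω → f ω + g ω) ≡ ∑ᶜ n f + ∑ᶜ n g
  ∑ᶜ-distrib-+ zero    f g = refl
  ∑ᶜ-distrib-+ (suc n) f g =
    trans (sum-cong-≗ {t} (λ c → ∑ᶜ-distrib-+ n (f ∘ (c ∷ᶜ_)) (g ∘ (c ∷ᶜ_)))) (∑-distrib-+ {t} (λ c → ∑ᶜ n (f ∘ (c ∷ᶜ_))) (λ c → ∑ᶜ n (g ∘ (c ∷ᶜ_))))

  ∑ᶜ-*ˡ : ∀ n k (f : Colouring n → ℕ) → ∑ᶜ n (λ ω → k * f ω) ≡ k * ∑ᶜ n f
  ∑ᶜ-*ˡ zero    k f = refl
  ∑ᶜ-*ˡ (suc n) k f = trans (sum-cong-≗ {t} (λ c → ∑ᶜ-*ˡ n k (f ∘ (c ∷ᶜ_)))) (sym (*-distribˡ-sum {t} k (λ c → ∑ᶜ n (f ∘ (c ∷ᶜ_)))))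

  ∑ᶜ-const : ∀ n k → ∑ᶜ n (λ _ → k) ≡ t ^ n * k
  ∑ᶜ-const zero    k = sym (+-identityʳ k)
  ∑ᶜ-const (suc n) k = begin-equality
    ∑[ c < t ] ∑ᶜ n (λ _ → k)   ≡⟨ sum-cong-≗ {t} (λ _ → ∑ᶜ-const n k) ⟩
    ∑[ c < t ] (t ^ n * k)      ≡⟨ ∑-const t (t ^ n * k) ⟩
    t * (t ^ n * k)             ≡⟨ *-assoc t (t ^ n) k ⟨
    t * t ^ n * k               ∎

  0<∑ᶜ⇒∃0< : ∀ n (f : Colouring n → ℕ) → 0 < ∑ᶜ n f → ∃ λ ω → 0 < f ω
  0<∑ᶜ⇒∃0< zero    f 0<∑f = _ , 0<∑f
  0<∑ᶜ⇒∃0< (suc n) f 0<∑f with 0<∑⇒∃0< _ 0<∑f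
  ... | c , 0<∑fc with 0<∑ᶜ⇒∃0< n (f ∘ (c ∷ᶜ_)) 0<∑fc
  ...   | ω , 0<fω = c ∷ᶜ ω , 0<fω

  ∑ᶜ-comm : ∀ n {k} (f : Fin k → Colouring n → ℕ) → ∑ᶜ n (λ ω → ∑[ w < k ] f w ω) ≡ ∑[ w < k ] ∑ᶜ n (f w)
  ∑ᶜ-comm n {zero}  f = trans (∑ᶜ-const n 0) (*-zeroʳ (t ^ n))
  ∑ᶜ-comm n {suc k} f =
    trans (∑ᶜ-distrib-+ n (f zero) (λ ω → ∑[ w < k ] f (suc w) ω)) (cong (∑ᶜ n (f zero) +_) (∑ᶜ-comm n (f ∘ suc)))

  ∑ᶜ-∏ : ∀ n (h : Fin n → Fin t → ℕ) → ∑ᶜ n (λ ω → ∏ n (λ u → h u (ω u))) ≡ ∏ n (λ u → ∑[ c < t ] h u c)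
  ∑ᶜ-∏ zero    h = refl
  ∑ᶜ-∏ (suc n) h = begin-equality
    ∑[ c < t ] ∑ᶜ n (λ ω → h zero c * ∏ n (λ u → h (suc u) (ω u)))  ≡⟨ sum-cong-≗ {t} (λ c → ∑ᶜ-*ˡ n (h zero c) _) ⟩
    ∑[ c < t ] (h zero c * ∑ᶜ n (λ ω → ∏ n (λ u → h (suc u) (ω u)))) ≡⟨ sum-cong-≗ {t} (λ c → cong (h zero c *_) (∑ᶜ-∏ n (h ∘ suc))) ⟩
    ∑[ c < t ] (h zero c * ∏ n (λ u → ∑[ c′ < t ] h (suc u) c′))     ≡⟨ *-distribʳ-sum {t} (∏ n (λ u → ∑[ c′ < t ] h (suc u) c′)) (h zero) ⟨
    ∑[ c < t ] h zero c * ∏ n (λ u → ∑[ c′ < t ] h (suc u) c′)       ∎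

  DependsOnly : ∀ {A : Set} {n} → (Fin n → Bool) → (Colouring n → A) → Set
  DependsOnly T f = ∀ ω ω′ → (∀ i → T i ≡ true → ω i ≡ ω′ i) → f ω ≡ f ω′

  DependsOnly-tail : ∀ {A : Set} {n} {T : Fin (suc n) → Bool} {f : Colouring (suc n) → A} →
                     DependsOnly T f → ∀ c → DependsOnly (T ∘ suc) (f ∘ (c ∷ᶜ_))
  DependsOnly-tail f-local c ω ω′ agree = f-local (c ∷ᶜ ω) (c ∷ᶜ ω′) λ { zero _ → refl ; (suc i) Ti → agree i Ti }

  ∑ᶜ-ignores-head : ∀ n {T : Fin (suc n) → Bool} {f : Colouring (suc n) → ℕ} → DependsOnly T f → T zero ≡ false →
                    ∀ c c′ → ∑ᶜ n (f ∘ (c ∷ᶜ_)) ≡ ∑ᶜ n (f ∘ (c′ ∷ᶜ_))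
  ∑ᶜ-ignores-head n f-local T0≡false c c′ = ∑ᶜ-cong n (λ ω → f-local (c ∷ᶜ ω) (c′ ∷ᶜ ω) agree)
    where
    agree : ∀ {ω} i → _ ≡ true → (c ∷ᶜ ω) i ≡ (c′ ∷ᶜ ω) i
    agree zero    T0≡true with trans (sym T0≡false) T0≡true
    ... | ()
    agree (suc i) _ = refl

  -- Functions of disjoint sets of coordinates are independent under the uniform distribution.
  ∑ᶜ-independent : ∀ n (T : Fin n → Bool) (f g : Colouring n → ℕ) →
                   DependsOnly T f → DependsOnly (not ∘ T) g → ∑ᶜ n (λ ω → f ω * g ω) * t ^ n ≡ ∑ᶜ n f * ∑ᶜ n g
  ∑ᶜ-independent zero    T f g _ _ = *-identityʳ _
  ∑ᶜ-independent (suc n) T f g f-local g-local = begin-equality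
    ∑[ c < t ] ∑ᶜ n (λ ω → fᶜ c ω * gᶜ c ω) * (t * t ^ n)  ≡⟨ cong (∑fg *_) (*-comm t (t ^ n)) ⟩
    ∑[ c < t ] ∑ᶜ n (λ ω → fᶜ c ω * gᶜ c ω) * (t ^ n * t)  ≡⟨ *-assoc ∑fg (t ^ n) t ⟨
    ∑[ c < t ] ∑ᶜ n (λ ω → fᶜ c ω * gᶜ c ω) * t ^ n * t    ≡⟨ cong (_* t) (*-distribʳ-sum {t} (t ^ n) (λ c → ∑ᶜ n (λ ω → fᶜ c ω * gᶜ c ω))) ⟩
    ∑[ c < t ] (∑ᶜ n (λ ω → fᶜ c ω * gᶜ c ω) * t ^ n) * t  ≡⟨ cong (_* t) (sum-cong-≗ {t} (λ c →
                                                                ∑ᶜ-independent n (T ∘ suc) (fᶜ c) (gᶜ c)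
                                                                  (DependsOnly-tail f-local c) (DependsOnly-tail g-local c))) ⟩
    ∑[ c < t ] (∑ᶜ n (fᶜ c) * ∑ᶜ n (gᶜ c)) * t             ≡⟨ split-head (T zero) refl ⟩
    ∑[ c < t ] ∑ᶜ n (fᶜ c) * ∑[ c < t ] ∑ᶜ n (gᶜ c)        ∎
    where
    fᶜ gᶜ : Fin t → Colouring n → ℕ
    fᶜ c = f ∘ (c ∷ᶜ_)
    gᶜ c = g ∘ (c ∷ᶜ_)
    ∑fg = ∑[ c < t ] ∑ᶜ n (λ ω → fᶜ c ω * gᶜ c ω)
    split-head : ∀ b → T zero ≡ b →
      ∑[ c < t ] (∑ᶜ n (fᶜ c) * ∑ᶜ n (gᶜ c)) * t ≡ ∑[ c < t ] ∑ᶜ n (fᶜ c) * ∑[ c < t ] ∑ᶜ n (gᶜ c)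
    split-head true  T0 = ∑[f*g]*k≡∑f*∑g t _ _ (∑ᶜ-ignores-head n g-local (cong not T0))
    split-head false T0 = begin-equality
      ∑[ c < t ] (∑ᶜ n (fᶜ c) * ∑ᶜ n (gᶜ c)) * t       ≡⟨ cong (_* t) (sum-cong-≗ {t} (λ c → *-comm (∑ᶜ n (fᶜ c)) _)) ⟩
      ∑[ c < t ] (∑ᶜ n (gᶜ c) * ∑ᶜ n (fᶜ c)) * t       ≡⟨ ∑[f*g]*k≡∑f*∑g t _ _ (∑ᶜ-ignores-head n f-local T0) ⟩
      ∑[ c < t ] ∑ᶜ n (gᶜ c) * ∑[ c < t ] ∑ᶜ n (fᶜ c)  ≡⟨ *-comm (∑[ c < t ] ∑ᶜ n (gᶜ c)) (∑[ c < t ] ∑ᶜ n (fᶜ c)) ⟩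
      ∑[ c < t ] ∑ᶜ n (fᶜ c) * ∑[ c < t ] ∑ᶜ n (gᶜ c)  ∎

y≤x+z⇒2z≤y⇒y≤2x : ∀ {x y z} → y ≤ x + z → 2 * z ≤ y → y ≤ 2 * x
y≤x+z⇒2z≤y⇒y≤2x {x} {y} {z} y≤x+z 2z≤y = +-cancelʳ-≤ y y (2 * x) (begin
  y + y           ≡⟨ cong (y +_) (+-identityʳ y) ⟨
  2 * y           ≤⟨ *-monoʳ-≤ 2 y≤x+z ⟩
  2 * (x + z)     ≡⟨ *-distribˡ-+ 2 x z ⟩
  2 * x + 2 * z   ≤⟨ +-monoʳ-≤ (2 * x) 2z≤y ⟩
  2 * x + y       ∎)

Overlap : ∀ {m n} → (Fin m → Fin n → Bool) → Fin m → Fin m → Bool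
Overlap {n = n} R v w = anyᶠ n (λ u → R v u ∧ R w u)

-- The Lovász local lemma in the variable setting, by counting colourings: the event
-- "good v" reads only the colours in R v, fails for at most t^n/(4D) colourings, and
-- its reading set meets that of at most D events.
module LocalLemma {m n t : ℕ} (1≤t : 1 ≤ t)
  (R : Fin m → Fin n → Bool) (good : Fin m → Colourings.Colouring t n → Bool)
  (good-local : ∀ v → Colourings.DependsOnly t (R v) (good v))
  (D : ℕ) (1≤D : 1 ≤ D)
  (rare : ∀ v → Colourings.∑ᶜ t n (λ ω → 𝟙 (not (good v ω))) * (4 * D) ≤ t ^ n)
  (sparse : ∀ v → ∑[ w < m ] 𝟙 (Overlap R v w) ≤ D)
  where

  open Colourings t

  GoodOn : (Fin m → Bool) → Colouring n → Bool
  GoodOn S ω = allᶠ m (λ w → not (S w) ∨ good w ω)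

  #Good : (Fin m → Bool) → ℕ
  #Good S = ∑ᶜ n (𝟙 ∘ GoodOn S)

  #BadGood : Fin m → (Fin m → Bool) → ℕ
  #BadGood v S = ∑ᶜ n (λ ω → 𝟙 (not (good v ω)) * 𝟙 (GoodOn S ω))

  size : (Fin m → Bool) → ℕ
  size S = ∑[ w < m ] 𝟙 (S w)

  _⊆_ : (Fin m → Bool) → (Fin m → Bool) → Set
  S ⊆ S′ = ∀ w → S w ≡ true → S′ w ≡ true

  size-< : ∀ {S S′ : Fin m → Bool} → S ⊆ S′ → ∀ w → S w ≡ false → S′ w ≡ true → size S < size S′
  size-< S⊆S′ w Sw S′w = ∑-mono-< (λ u → 𝟙-mono (S⊆S′ u)) w (subst₂ (λ a b → 𝟙 a < 𝟙 b) (sym Sw) (sym S′w) z<s)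

  GoodOn-antitone : ∀ {S S′ : Fin m → Bool} → S′ ⊆ S → ∀ ω → GoodOn S ω ≡ true → GoodOn S′ ω ≡ true
  GoodOn-antitone {S} {S′} S′⊆S ω good-S = ∀⇒allᶠ (λ w → weaken w (allᶠ⇒∀ good-S w))
    where
    weaken : ∀ w → (not (S w) ∨ good w ω) ≡ true → (not (S′ w) ∨ good w ω) ≡ true
    weaken w h with S′ w in S′w
    ... | false = refl
    ... | true rewrite S′⊆S w S′w = h

  GoodOn-gap : ∀ {S S′ : Fin m → Bool} ω → GoodOn S ω ≡ false → GoodOn S′ ω ≡ true →
               ∃ λ u → S u ≡ true × S′ u ≡ false × good u ω ≡ false
  GoodOn-gap {S} {S′} ω ¬good-S good-S′ with ¬allᶠ⇒∃ ¬good-S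
  ... | u , h = u , not-injective (∨-conicalˡ (not (S u)) _ h) , not-injective ¬S′u , bad-u
    where
    bad-u : good u ω ≡ false
    bad-u = ∨-conicalʳ (not (S u)) _ h
    ¬S′u : not (S′ u) ≡ true
    ¬S′u = trans (sym (∨-identityʳ (not (S′ u)))) (subst (λ b → not (S′ u) ∨ b ≡ true) bad-u (allᶠ⇒∀ good-S′ u))

  -- The union bound, with T covering S ∖ S′.
  #Good-split : ∀ {S S′ T : Fin m → Bool} → (∀ u → S u ≡ true → S′ u ≡ false → T u ≡ true) →
                #Good S′ ≤ #Good S + ∑[ w < m ] (𝟙 (T w) * #BadGood w S′)
  #Good-split {S} {S′} {T} cover = begin
    ∑ᶜ n (𝟙 ∘ GoodOn S′)                                      ≤⟨ ∑ᶜ-mono-≤ n pointwise ⟩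
    ∑ᶜ n (λ ω → 𝟙 (GoodOn S ω) + ∑[ w < m ] F w ω)            ≡⟨ ∑ᶜ-distrib-+ n (𝟙 ∘ GoodOn S) _ ⟩
    #Good S + ∑ᶜ n (λ ω → ∑[ w < m ] F w ω)                   ≡⟨ cong (#Good S +_) (∑ᶜ-comm n F) ⟩
    #Good S + ∑[ w < m ] ∑ᶜ n (F w)                           ≡⟨ cong (#Good S +_) (sum-cong-≗ {m} (λ w → ∑ᶜ-*ˡ n (𝟙 (T w)) _)) ⟩
    #Good S + ∑[ w < m ] (𝟙 (T w) * #BadGood w S′)            ∎
    where
    F : Fin m → Colouring n → ℕ
    F w ω = 𝟙 (T w) * (𝟙 (not (good w ω)) * 𝟙 (GoodOn S′ ω))
    pointwise : ∀ ω → 𝟙 (GoodOn S′ ω) ≤ 𝟙 (GoodOn S ω) + ∑[ w < m ] F w ω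
    pointwise ω with GoodOn S ω in good-S | GoodOn S′ ω in good-S′
    ... | true  | b     = ≤-trans (𝟙≤1 b) (s≤s z≤n)
    ... | false | false = z≤n
    ... | false | true with GoodOn-gap ω good-S good-S′
    ...   | u , Su , S′u , bad-u = ≤-trans (≤-reflexive (sym term-u≡1)) (f[i]≤∑f term u)
      where
      term : Fin m → ℕ
      term w = 𝟙 (T w) * (𝟙 (not (good w ω)) * 1)
      term-u≡1 : term u ≡ 1
      term-u≡1 rewrite cover u Su S′u | bad-u = refl

  avoid : (Fin m → Bool) → Fin m → Fin m → Bool
  avoid S v w = S w ∧ not (Overlap R v w)

  avoid⊆ : ∀ S v → avoid S v ⊆ S
  avoid⊆ S v w = ∧-conicalˡ (S w) _

  GoodOn-avoid-local : ∀ S v → DependsOnly (not ∘ R v) (𝟙 ∘ GoodOn (avoid S v))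
  GoodOn-avoid-local S v ω ω′ agree = cong 𝟙 (allᶠ-cong m same)
    where
    meets : ∀ w u → R v u ≡ true → R w u ≡ true → Overlap R v w ≡ true
    meets w u Rvu Rwu = ∃⇒anyᶠ u (subst₂ (λ a b → a ∧ b ≡ true) (sym Rvu) (sym Rwu) refl)
    same : ∀ w → (not (avoid S v w) ∨ good w ω) ≡ (not (avoid S v w) ∨ good w ω′)
    same w with avoid S v w in avoids
    ... | false = refl
    ... | true  = good-local w ω ω′ λ u Rwu → agree u (disjoint u Rwu)
      where
      disjoint : ∀ u → R w u ≡ true → not (R v u) ≡ true
      disjoint u Rwu with R v u in Rvu
      ... | false = refl
      ... | true with trans (sym (cong not (meets w u Rvu Rwu))) (∧-conicalʳ (S w) _ avoids)
      ...   | ()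

  #BadGood-avoid : ∀ S v → #BadGood v (avoid S v) * (4 * D) ≤ #Good (avoid S v)
  #BadGood-avoid S v = *-cancelʳ-≤ _ _ (t ^ n) {{m^n≢0 t n {{>-nonZero 1≤t}}}} (begin
    #BadGood v S₂ * (4 * D) * t ^ n      ≡⟨ xy∙z≈xz∙y (#BadGood v S₂) (4 * D) (t ^ n) ⟩
    #BadGood v S₂ * t ^ n * (4 * D)      ≡⟨ cong (_* (4 * D)) (∑ᶜ-independent n (R v) _ _ bad-local (GoodOn-avoid-local S v)) ⟩
    #bad * #Good S₂ * (4 * D)            ≡⟨ xy∙z≈xz∙y #bad (#Good S₂) (4 * D) ⟩
    #bad * (4 * D) * #Good S₂            ≤⟨ *-monoˡ-≤ (#Good S₂) (rare v) ⟩
    t ^ n * #Good S₂                     ≡⟨ *-comm (t ^ n) (#Good S₂) ⟩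
    #Good S₂ * t ^ n                     ∎)
    where
    S₂ = avoid S v
    #bad = ∑ᶜ n (λ ω → 𝟙 (not (good v ω)))
    bad-local : DependsOnly (R v) (λ ω → 𝟙 (not (good v ω)))
    bad-local ω ω′ agree = cong (𝟙 ∘ not) (good-local v ω ω′ agree)

  #Good-avoid≤2*#Good : ∀ S v →
    (∀ w → (S w ∧ Overlap R v w) ≡ true → #BadGood w (avoid S v) * (2 * D) ≤ #Good (avoid S v)) →
    #Good (avoid S v) ≤ 2 * #Good S
  #Good-avoid≤2*#Good S v IH = y≤x+z⇒2z≤y⇒y≤2x {#Good S} {Y₂} {Z} (#Good-split cover) 2Z≤Y₂
    where
    S₂ = avoid S v
    Y₂ = #Good S₂
    Z = ∑[ w < m ] (𝟙 (S w ∧ Overlap R v w) * #BadGood w S₂)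
    cover : ∀ u → S u ≡ true → S₂ u ≡ false → (S u ∧ Overlap R v u) ≡ true
    cover u Su  S₂u with S u | Overlap R v u
    cover u Su  S₂u | true | true  = refl
    cover u Su  S₂u | true | false = sym S₂u
    cover u () S₂u | false | _
    term : ∀ w → 𝟙 (S w ∧ Overlap R v w) * #BadGood w S₂ * (2 * D) ≤ 𝟙 (Overlap R v w) * Y₂
    term w with S w ∧ Overlap R v w in h
    ... | false = z≤n
    ... | true rewrite ∧-conicalʳ (S w) _ h = begin
      1 * #BadGood w S₂ * (2 * D)   ≡⟨ cong (_* (2 * D)) (*-identityˡ (#BadGood w S₂)) ⟩
      #BadGood w S₂ * (2 * D)       ≤⟨ IH w h ⟩
      Y₂                            ≡⟨ *-identityˡ Y₂ ⟨
      1 * Y₂                        ∎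
    Z*2D≤D*Y₂ : Z * (2 * D) ≤ D * Y₂
    Z*2D≤D*Y₂ = begin
      Z * (2 * D)                                       ≡⟨ *-distribʳ-sum {m} (2 * D) _ ⟩
      ∑[ w < m ] (𝟙 (S w ∧ Overlap R v w) * #BadGood w S₂ * (2 * D)) ≤⟨ ∑-mono-≤ term ⟩
      ∑[ w < m ] (𝟙 (Overlap R v w) * Y₂)               ≡⟨ *-distribʳ-sum {m} Y₂ _ ⟨
      ∑[ w < m ] 𝟙 (Overlap R v w) * Y₂                 ≤⟨ *-monoˡ-≤ Y₂ (sparse v) ⟩
      D * Y₂                                            ∎
    2Z≤Y₂ : 2 * Z ≤ Y₂
    2Z≤Y₂ = *-cancelʳ-≤ _ _ D {{>-nonZero 1≤D}} (begin
      2 * Z * D      ≡⟨ xy∙z≈y∙xz′ ⟩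
      Z * (2 * D)    ≤⟨ Z*2D≤D*Y₂ ⟩
      D * Y₂         ≡⟨ *-comm D Y₂ ⟩
      Y₂ * D         ∎)
      where
      xy∙z≈y∙xz′ : 2 * Z * D ≡ Z * (2 * D)
      xy∙z≈y∙xz′ = trans (cong (_* D) (*-comm 2 Z)) (*-assoc Z 2 D)

  #BadGood-antitone : ∀ {S S′ : Fin m → Bool} v → S′ ⊆ S → #BadGood v S ≤ #BadGood v S′
  #BadGood-antitone v S′⊆S =
    ∑ᶜ-mono-≤ n (λ ω → *-monoʳ-≤ (𝟙 (not (good v ω))) (𝟙-mono (GoodOn-antitone S′⊆S ω)))

  -- The conditional probability of failure at v, given success on S, is at most 1/(2D).
  bad-bound : ∀ k S → size S < k → ∀ v → #BadGood v S * (2 * D) ≤ #Good S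
  bad-bound (suc k) S (s≤s size≤k) v = *-cancelʳ-≤ _ _ 2 (begin
    #BadGood v S * (2 * D) * 2   ≡⟨ double (#BadGood v S) D ⟩
    #BadGood v S * (4 * D)       ≤⟨ *-monoˡ-≤ (4 * D) (#BadGood-antitone v (avoid⊆ S v)) ⟩
    #BadGood v S₂ * (4 * D)      ≤⟨ #BadGood-avoid S v ⟩
    #Good S₂                     ≤⟨ #Good-avoid≤2*#Good S v IH ⟩
    2 * #Good S                  ≡⟨ *-comm 2 (#Good S) ⟩
    #Good S * 2                  ∎)
    where
    S₂ = avoid S v
    IH : ∀ w → (S w ∧ Overlap R v w) ≡ true → #BadGood w S₂ * (2 * D) ≤ #Good S₂
    IH w h = bad-bound k S₂ (<-≤-trans (size-< (avoid⊆ S v) w S₂w (∧-conicalˡ (S w) _ h)) size≤k) w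
      where
      S₂w : S₂ w ≡ false
      S₂w rewrite ∧-conicalʳ (S w) _ h = ∧-zeroʳ (S w)
    double : ∀ x D → x * (2 * D) * 2 ≡ x * (4 * D)
    double = solve-∀

  0<#Good : ∀ k S → size S < k → 0 < #Good S
  0<#Good (suc k) S (s≤s size≤k) with anyᶠ m S in nonempty
  ... | false = subst (0 <_) (sym #Good≡t^n*1) (*-monoˡ-≤ 1 (m^n>0 t {{>-nonZero 1≤t}} n))
    where
    #Good≡t^n*1 : #Good S ≡ t ^ n * 1
    #Good≡t^n*1 = trans (∑ᶜ-cong n (λ ω → cong 𝟙 (∀⇒allᶠ (λ w → cong (λ b → not b ∨ good w ω) (¬anyᶠ⇒∀ nonempty w)))))
                        (∑ᶜ-const n 1)
  ... | true with anyᶠ⇒∃ nonempty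
  ...   | w , Sw = 0<2x⇒0<x (<-≤-trans 0<#Good[S′] (y≤x+z⇒2z≤y⇒y≤2x {#Good S} {#Good S′} {#BadGood w S′} split 2B≤#Good[S′]))
    where
    S′ : Fin m → Bool
    S′ u = S u ∧ not (u == w)
    S′⊆S : S′ ⊆ S
    S′⊆S u = ∧-conicalˡ (S u) _
    S′w : S′ w ≡ false
    S′w rewrite ==-refl w = ∧-zeroʳ (S w)
    0<#Good[S′] : 0 < #Good S′
    0<#Good[S′] = 0<#Good k S′ (<-≤-trans (size-< S′⊆S w S′w Sw) size≤k)
    cover : ∀ u → S u ≡ true → S′ u ≡ false → (u == w) ≡ true
    cover u Su S′u rewrite Su = not-injective S′u
    split : #Good S′ ≤ #Good S + #BadGood w S′
    split = subst (λ z → #Good S′ ≤ #Good S + z) (∑-δ (λ u → #BadGood u S′) w) (#Good-split cover)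
    2B≤#Good[S′] : 2 * #BadGood w S′ ≤ #Good S′
    2B≤#Good[S′] = begin
      2 * #BadGood w S′          ≡⟨ *-comm 2 (#BadGood w S′) ⟩
      #BadGood w S′ * 2          ≤⟨ *-monoʳ-≤ (#BadGood w S′) (*-monoʳ-≤ 2 1≤D) ⟩
      #BadGood w S′ * (2 * D)    ≤⟨ bad-bound (suc (size S′)) S′ (n<1+n (size S′)) w ⟩
      #Good S′                   ∎
    0<2x⇒0<x : ∀ {x} → 0 < 2 * x → 0 < x
    0<2x⇒0<x {suc x} _ = z<s

  local-lemma : ∃ λ ω → ∀ v → good v ω ≡ true
  local-lemma with 0<∑ᶜ⇒∃0< n _ (0<#Good (suc (size (λ _ → true))) (λ _ → true) (n<1+n _))
  ... | ω , 0<𝟙 = ω , allᶠ⇒∀ (0<𝟙⇒≡true 0<𝟙)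

module DominatingColouring {n : ℕ} (t : ℕ) (1≤t : 1 ≤ t) (G : Graph n) (d : ℕ) (reg : Regular d G) where

  open Colourings t

  N : Fin n → Fin n → Bool
  N v u = lookup (nbr G v) u

  N-sym : ∀ v u → N v u ≡ N u v
  N-sym v u with N v u in vu | N u v in uv
  ... | true  | true  = refl
  ... | false | false = refl
  ... | true  | false with trans (sym uv) ([]=⇒lookup (symmetric G v u (lookup⇒[]= u (nbr G v) vu)))
  ...   | ()
  N-sym v u | false | true with trans (sym vu) ([]=⇒lookup (symmetric G u v (lookup⇒[]= v (nbr G u) uv)))
  ...   | ()

  ∑𝟙[p]≡∣p∣ : ∀ {k} (p : Subset k) → ∑[ u < k ] 𝟙 (lookup p u) ≡ ∣ p ∣
  ∑𝟙[p]≡∣p∣ []          = refl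
  ∑𝟙[p]≡∣p∣ (true  ∷ p) = cong suc (∑𝟙[p]≡∣p∣ p)
  ∑𝟙[p]≡∣p∣ (false ∷ p) = ∑𝟙[p]≡∣p∣ p

  degree : ∀ v → ∑[ u < n ] 𝟙 (N v u) ≡ d
  degree v = trans (∑𝟙[p]≡∣p∣ (nbr G v)) (reg v)

  sees : Colouring n → Fin n → Fin t → Bool
  sees ω v i = anyᶠ n (λ u → N v u ∧ (ω u == i))

  dominated : Fin n → Colouring n → Bool
  dominated v ω = allᶠ t (sees ω v)

  dominated-local : ∀ v → DependsOnly (N v) (dominated v)
  dominated-local v ω ω′ agree = allᶠ-cong t (λ i → anyᶠ-cong n (same-colour i))
    where
    same-colour : ∀ i u → (N v u ∧ (ω u == i)) ≡ (N v u ∧ (ω′ u == i))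
    same-colour i u with N v u in vu
    ... | true  = cong (_== i) (agree u vu)
    ... | false = refl

  colours-avoiding : Bool → ℕ
  colours-avoiding true  = t ∸ 1
  colours-avoiding false = t

  ∑[c≠i]≡colours-avoiding : ∀ b (i : Fin t) → ∑[ c < t ] 𝟙 (not (b ∧ (c == i))) ≡ colours-avoiding b
  ∑[c≠i]≡colours-avoiding false i = trans (∑-const t 1) (*-identityʳ t)
  ∑[c≠i]≡colours-avoiding true  i = +-cancelʳ-≡ 1 _ _ (begin-equality
    ∑[ c < t ] 𝟙 (not (c == i)) + 1                            ≡⟨ cong (∑[ c < t ] 𝟙 (not (c == i)) +_) (∑-δ (λ _ → 1) i) ⟨
    ∑[ c < t ] 𝟙 (not (c == i)) + ∑[ c < t ] (𝟙 (c == i) * 1) ≡⟨ ∑-distrib-+ {t} (λ c → 𝟙 (not (c == i))) (λ c → 𝟙 (c == i) * 1) ⟨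
    ∑[ c < t ] (𝟙 (not (c == i)) + 𝟙 (c == i) * 1)            ≡⟨ sum-cong-≗ {t} (λ c → trans (cong (𝟙 (not (c == i)) +_) (*-identityʳ _)) (𝟙-not+𝟙 (c == i))) ⟩
    ∑[ c < t ] 1                                                ≡⟨ trans (∑-const t 1) (*-identityʳ t) ⟩
    t                                                           ≡⟨ m∸n+n≡m 1≤t ⟨
    t ∸ 1 + 1                                                   ∎)

  ∏colours-avoiding : ∀ {k} (p : Subset k) → ∏ k (colours-avoiding ∘ lookup p) * t ^ ∣ p ∣ ≡ (t ∸ 1) ^ ∣ p ∣ * t ^ k
  ∏colours-avoiding []          = refl
  ∏colours-avoiding {suc k} (true ∷ p) = begin-equality
    (t ∸ 1) * P * (t * t ^ c)               ≡⟨ shuffle₁ (t ∸ 1) P t (t ^ c) ⟩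
    (t ∸ 1) * t * (P * t ^ c)               ≡⟨ cong ((t ∸ 1) * t *_) (∏colours-avoiding p) ⟩
    (t ∸ 1) * t * ((t ∸ 1) ^ c * t ^ k)     ≡⟨ shuffle₂ (t ∸ 1) t ((t ∸ 1) ^ c) (t ^ k) ⟩
    (t ∸ 1) * (t ∸ 1) ^ c * (t * t ^ k)     ∎
    where
    P = ∏ k (colours-avoiding ∘ lookup p)
    c = ∣ p ∣
    shuffle₁ : ∀ a p t x → a * p * (t * x) ≡ a * t * (p * x)
    shuffle₁ = solve-∀
    shuffle₂ : ∀ a t y z → a * t * (y * z) ≡ a * y * (t * z)
    shuffle₂ = solve-∀
  ∏colours-avoiding {suc k} (false ∷ p) = begin-equality
    t * P * t ^ ∣ p ∣                 ≡⟨ *-assoc t P (t ^ ∣ p ∣) ⟩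
    t * (P * t ^ ∣ p ∣)               ≡⟨ cong (t *_) (∏colours-avoiding p) ⟩
    t * ((t ∸ 1) ^ ∣ p ∣ * t ^ k)     ≡⟨ x∙yz≈y∙xz t ((t ∸ 1) ^ ∣ p ∣) (t ^ k) ⟩
    (t ∸ 1) ^ ∣ p ∣ * (t * t ^ k)     ∎
    where
    P = ∏ k (colours-avoiding ∘ lookup p)

  #missing : ∀ v i → ∑ᶜ n (λ ω → 𝟙 (not (sees ω v i))) ≡ ∏ n (colours-avoiding ∘ N v)
  #missing v i = begin-equality
    ∑ᶜ n (λ ω → 𝟙 (not (sees ω v i)))                                  ≡⟨ ∑ᶜ-cong n (λ ω → 𝟙-not-anyᶠ≡∏ n _) ⟩
    ∑ᶜ n (λ ω → ∏ n (λ u → 𝟙 (not (N v u ∧ (ω u == i)))))              ≡⟨ ∑ᶜ-∏ n (λ u c → 𝟙 (not (N v u ∧ (c == i)))) ⟩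
    ∏ n (λ u → ∑[ c < t ] 𝟙 (not (N v u ∧ (c == i))))                  ≡⟨ ∏-cong n (λ u → ∑[c≠i]≡colours-avoiding (N v u) i) ⟩
    ∏ n (colours-avoiding ∘ N v)                                        ∎

  #undominated : ∀ v → ∑ᶜ n (λ ω → 𝟙 (not (dominated v ω))) * t ^ d ≤ t * (t ∸ 1) ^ d * t ^ n
  #undominated v = begin
    ∑ᶜ n (λ ω → 𝟙 (not (dominated v ω))) * t ^ d                ≤⟨ *-monoˡ-≤ (t ^ d) (∑ᶜ-mono-≤ n (λ ω → 𝟙-not-allᶠ≤∑ t (sees ω v))) ⟩
    ∑ᶜ n (λ ω → ∑[ i < t ] 𝟙 (not (sees ω v i))) * t ^ d       ≡⟨ cong (_* t ^ d) (∑ᶜ-comm n (λ i ω → 𝟙 (not (sees ω v i)))) ⟩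
    ∑[ i < t ] ∑ᶜ n (λ ω → 𝟙 (not (sees ω v i))) * t ^ d       ≡⟨ cong (_* t ^ d) (trans (sum-cong-≗ {t} (#missing v)) (∑-const t P)) ⟩
    t * P * t ^ d                                              ≡⟨ *-assoc t P (t ^ d) ⟩
    t * (P * t ^ d)                                            ≡⟨ cong (t *_) (subst (λ x → P * t ^ x ≡ (t ∸ 1) ^ x * t ^ n) (reg v) (∏colours-avoiding (nbr G v))) ⟩
    t * ((t ∸ 1) ^ d * t ^ n)                                  ≡⟨ *-assoc t ((t ∸ 1) ^ d) (t ^ n) ⟨
    t * (t ∸ 1) ^ d * t ^ n                                    ∎
    where
    P = ∏ n (colours-avoiding ∘ N v)

  overlap-degree : ∀ v → ∑[ w < n ] 𝟙 (Overlap N v w) ≤ d * d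
  overlap-degree v = begin
    ∑[ w < n ] 𝟙 (Overlap N v w)                                  ≤⟨ ∑-mono-≤ {n} (λ w → 𝟙-anyᶠ≤∑ n (λ u → N v u ∧ N w u)) ⟩
    ∑[ w < n ] ∑[ u < n ] 𝟙 (N v u ∧ N w u)                       ≡⟨ sum-cong-≗ {n} (λ w → sum-cong-≗ {n} (λ u → 𝟙-∧ (N v u) (N w u))) ⟩
    ∑[ w < n ] ∑[ u < n ] (𝟙 (N v u) * 𝟙 (N w u))                 ≡⟨ ∑-comm {n} {n} (λ w u → 𝟙 (N v u) * 𝟙 (N w u)) ⟩
    ∑[ u < n ] ∑[ w < n ] (𝟙 (N v u) * 𝟙 (N w u))                 ≡⟨ sum-cong-≗ {n} (λ u → sym (*-distribˡ-sum {n} (𝟙 (N v u)) (λ w → 𝟙 (N w u)))) ⟩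
    ∑[ u < n ] (𝟙 (N v u) * ∑[ w < n ] 𝟙 (N w u))                 ≡⟨ sum-cong-≗ {n} (λ u → cong (𝟙 (N v u) *_) (codegree u)) ⟩
    ∑[ u < n ] (𝟙 (N v u) * d)                                    ≡⟨ *-distribʳ-sum {n} d (λ u → 𝟙 (N v u)) ⟨
    ∑[ u < n ] 𝟙 (N v u) * d                                      ≡⟨ cong (_* d) (degree v) ⟩
    d * d                                                         ∎
    where
    codegree : ∀ u → ∑[ w < n ] 𝟙 (N w u) ≡ d
    codegree u = trans (sum-cong-≗ {n} (λ w → cong 𝟙 (N-sym w u))) (degree u)

  dominating-colouring : 1 ≤ d → 4 * (d * d) * t * (t ∸ 1) ^ d ≤ t ^ d → ∃ λ ω → ∀ v → dominated v ω ≡ true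
  dominating-colouring 1≤d 4d²t[t∸1]^d≤t^d =
    LocalLemma.local-lemma 1≤t N dominated dominated-local (d * d) (*-mono-≤ 1≤d 1≤d) rare overlap-degree
    where
    rare : ∀ v → ∑ᶜ n (λ ω → 𝟙 (not (dominated v ω))) * (4 * (d * d)) ≤ t ^ n
    rare v = *-cancelʳ-≤ _ _ (t ^ d) {{m^n≢0 t d {{>-nonZero 1≤t}}}} (begin
      B * (4 * (d * d)) * t ^ d              ≡⟨ xy∙z≈xz∙y B (4 * (d * d)) (t ^ d) ⟩
      B * t ^ d * (4 * (d * d))              ≤⟨ *-monoˡ-≤ (4 * (d * d)) (#undominated v) ⟩
      t * (t ∸ 1) ^ d * t ^ n * (4 * (d * d)) ≡⟨ shuffle t ((t ∸ 1) ^ d) (t ^ n) (4 * (d * d)) ⟩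
      4 * (d * d) * t * (t ∸ 1) ^ d * t ^ n  ≤⟨ *-monoˡ-≤ (t ^ n) 4d²t[t∸1]^d≤t^d ⟩
      t ^ d * t ^ n                          ≡⟨ *-comm (t ^ d) (t ^ n) ⟩
      t ^ n * t ^ d                          ∎)
      where
      B = ∑ᶜ n (λ ω → 𝟙 (not (dominated v ω)))
      shuffle : ∀ t a x c → t * a * x * c ≡ c * t * a * x
      shuffle = solve-∀

  colour-classes : Colouring n → Fin t → Subset n
  colour-classes ω i = tabulate (λ u → ω u == i)

  coloured⇒∈ : ∀ ω {u i} → ω u ≡ i → u ∈ colour-classes ω i
  coloured⇒∈ ω {u} refl = lookup⇒[]= u _ (trans (lookup∘tabulate (λ u′ → ω u′ == ω u) u) (==-refl (ω u)))

  ∈⇒coloured : ∀ ω {u i} → u ∈ colour-classes ω i → ω u ≡ i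
  ∈⇒coloured ω {u} {i} u∈ = ==⇒≡ (trans (sym (lookup∘tabulate (λ u → ω u == i) u)) ([]=⇒lookup u∈))

  dominated⇒neighbour : ∀ ω v i → dominated v ω ≡ true → ∃ λ u → u ∈ colour-classes ω i × Adj G v u
  dominated⇒neighbour ω v i dom with anyᶠ⇒∃ (allᶠ⇒∀ dom i)
  ... | u , h = u , coloured⇒∈ ω (==⇒≡ (∧-conicalʳ (N v u) _ h)) , lookup⇒[]= u (nbr G v) (∧-conicalˡ (N v u) _ h)

  colour-classes-model : ∀ ω → 1 ≤ n → (∀ v → dominated v ω ≡ true) → DomPseudoModel G t (colour-classes ω)
  colour-classes-model ω 1≤n all-dominated = nonempty , disjoint , dominating
    where
    nonempty : ∀ i → Nonempty (colour-classes ω i)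
    nonempty i = let u , u∈ , _ = dominated⇒neighbour ω (fromℕ< 1≤n) i (all-dominated (fromℕ< 1≤n)) in u , u∈
    disjoint : ∀ i j → ¬ i ≡ j → ∀ u → u ∈ colour-classes ω i → u ∉ colour-classes ω j
    disjoint i j i≢j u u∈i u∈j = i≢j (trans (sym (∈⇒coloured ω u∈i)) (∈⇒coloured ω u∈j))
    dominating : ∀ i j → i <ᶠ j → ∀ v → v ∈ colour-classes ω j → ∃ λ u → u ∈ colour-classes ω i × Adj G v u
    dominating i _ _ v _ = dominated⇒neighbour ω v i (all-dominated v)

proposition20 : ∃ λ (t₀ : ℕ) → ∀ (t : ℕ) → t₀ ≤ t → ∀ (d : ℕ) → IsCeil4TLnT t d →
                  ∀ (n : ℕ) → 1 ≤ n → (G : Graph n) → Regular d G → HasDomPseudoModel G t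
proposition20 = T₀ , λ t T₀≤t d (4tlnt≤d , _) n 1≤n G reg →
  let 1≤t = ≤-trans (s≤s z≤n) (≤-trans 2≤T₀ T₀≤t)
      1≤d = ≤-trans (s≤s z≤n) (3000≤d T₀≤t 4tlnt≤d)
      open DominatingColouring t 1≤t G d reg
      ω , all-dominated = dominating-colouring 1≤d (4d²t[t∸1]^d≤t^d T₀≤t 4tlnt≤d)
  in colour-classes ω , colour-classes-model ω 1≤n all-dominated
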